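{- Let $M_n$ denote the $n$th Motzkin number. Then the set $\{n \in \mathbb{N} : M_n \equiv 0 \pmod 2\}$ has asymptotic density $\frac{1}{3}$; the set $\{n \in \mathbb{N} : M_n \equiv 4 \pmod 8\}$ has asymptotic density $\frac{1}{6}$; and each of the sets $\{n \in \mathbb{N} : M_n \equiv 2 \pmod 8\}$ and $\{n \in \mathbb{N} : M_n \equiv 6 \pmod 8\}$ has asymptotic density $\frac{1}{12}$.
   Context: $\mathbb{N} = \{0,1,2,\dots\}$. The Motzkin numbers are $M_n = \sum_{k \geq 0} \binom{n}{2k} C_k$ for $n \in \mathbb{N}$, where $C_k = \frac{1}{k+1}\binom{2k}{k}$ is the $k$th Catalan number. The asymptotic density of a subset $A \subseteq \mathbb{N}$ is $\lim_{N\to\infty} \frac{1}{N}\#\{n \in A : n \leq N\}$, if this limit exists. -}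

module Defs where

open import Data.Nat using (ℕ; zero; suc; _+_; _*_; _≤_; _/_; _%_)
open import Data.Nat.Combinatorics using (_C_)
open import Data.Bool using (Bool; true; false; if_then_else_)
open import Data.Integer using (+_)
open import Data.Product using (∃)
import Data.Rational as ℚ
open ℚ using (ℚ; 0ℚ; ∣_∣; _-_; _<_)

-- Catalan number C_k = binom(2k,k)/(k+1)  (exact division)
catalan : ℕ → ℕ
catalan k = ((2 * k) C k) / suc k

sumTo : (ℕ → ℕ) → ℕ → ℕ
sumTo f zero    = f zero
sumTo f (suc m) = sumTo f m + f (suc m)

-- Motzkin number M_n = Σ_{k ≥ 0} binom(n,2k) C_k ; terms with k > n vanish
motzkin : ℕ → ℕ
motzkin n = sumTo (λ k → (n C (2 * k)) * catalan k) n

countUpTo : (ℕ → Bool) → ℕ → ℕ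
countUpTo A zero    = if A zero then 1 else 0
countUpTo A (suc N) = countUpTo A N + (if A (suc N) then 1 else 0)

-- A has asymptotic density q:  (1/N) #{n ∈ A : n ≤ N} → q as N → ∞
-- (sequence indexed by N = suc m, so that 1/N is defined; rational ε suffices)
HasDensity : (ℕ → Bool) → ℚ → Set
HasDensity A q =
  ∀ (ε : ℚ) → 0ℚ < ε →
  ∃ λ (m₀ : ℕ) → ∀ (m : ℕ) → m₀ ≤ m →
    ∣ ((+ countUpTo A (suc m)) ℚ./ suc m) - q ∣ < ε

-- The Motzkin number M n is the difference [x^n] P^n - [x^(n+2)] P^n of two coefficients of powers of
-- P = 1 + x + x², and P(x)^8 ≡ P(x²)^4 modulo 8.  Hence the sequence c_W m = [x^(4m+6)] P^(4m) W
-- satisfies c_W (2m + b) ≡ c_(W_b) m (mod 8) for explicit series W_b, and reducing W modulo 8 leaves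
-- finitely many (125) polynomials.  A certified table shows that along them the class of c_W m modulo 8
-- (odd, 0, 2, 4 or 6) is a function of a 16-state automaton reading the binary digits of m.
-- Consequently, in each block n = 4m, …, 4m + 3 the number of n with M n in a given class is a
-- combination of two bits of that automaton: whether the trailing run of ones of m has even length,
-- and the parity of the number of ones.  The first holds for 2K/3 + O(log K) of the m < K, and the
-- signed count of the second is O(log K), which gives the densities 4/12, 2/12, 1/12 and 1/12.

module Submission where

module PowerSeries where

  open import Data.Nat as ℕ using (ℕ; zero; suc; _<_; s≤s)
  open import Data.Integer using (ℤ; 0ℤ; 1ℤ; _+_; _*_; -_)
  import Data.Integer.Properties as ℤP
  open import Data.Integer.Tactic.RingSolver using (solve-∀)
  open import Data.Product using (_,_)
  open import Function using (_∘_)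
  open import Level using (0ℓ)
  open import Algebra.Bundles using (CommutativeRing)
  open import Relation.Binary.Bundles using (Setoid)
  open import Relation.Binary.PropositionalEquality
  import Relation.Binary.Reasoning.Setoid

  Series : Set
  Series = ℕ → ℤ

  infix 4 _≈_
  _≈_ : Series → Series → Set
  _≈_ = _≗_

  open Setoid (ℕ →-setoid ℤ) public
    using () renaming (isEquivalence to ≈-isEquivalence; refl to ≈-refl; sym to ≈-sym; trans to ≈-trans)

  infixl 6 _⊕_
  infixl 7 _⊛_

  _⊕_ : Series → Series → Series
  (f ⊕ g) n = f n + g n

  ⊝_ : Series → Series
  (⊝ f) n = - f n

  0s 1s : Series
  0s _ = 0ℤ
  1s zero    = 1ℤ
  1s (suc _) = 0ℤ

  scale : ℤ → Series → Series
  scale c f n = c * f n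

  tail : Series → Series
  tail f = f ∘ suc

  _⊛_ : Series → Series → Series
  (f ⊛ g) zero    = f 0 * g 0
  (f ⊛ g) (suc n) = f 0 * g (suc n) + (tail f ⊛ g) n

  ⊕-cong : ∀ {f f′ g g′} → f ≈ f′ → g ≈ g′ → f ⊕ g ≈ f′ ⊕ g′
  ⊕-cong e e′ n = cong₂ _+_ (e n) (e′ n)

  ⊛-cong : ∀ {f f′ g g′} → f ≈ f′ → g ≈ g′ → f ⊛ g ≈ f′ ⊛ g′
  ⊛-cong ef eg zero    = cong₂ _*_ (ef 0) (eg 0)
  ⊛-cong ef eg (suc n) = cong₂ _+_ (cong₂ _*_ (ef 0) (eg (suc n))) (⊛-cong (ef ∘ suc) eg n)

  ⊛-congˡ : ∀ {f g g′} → g ≈ g′ → f ⊛ g ≈ f ⊛ g′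
  ⊛-congˡ = ⊛-cong ≈-refl

  ⊛-congʳ : ∀ {f f′ g} → f ≈ f′ → f ⊛ g ≈ f′ ⊛ g
  ⊛-congʳ e = ⊛-cong e ≈-refl

  ⊛-zeroˡ : ∀ g → 0s ⊛ g ≈ 0s
  ⊛-zeroˡ g zero    = refl
  ⊛-zeroˡ g (suc n) = cong (0ℤ +_) (⊛-zeroˡ g n)

  ⊛-identityˡ : ∀ g → 1s ⊛ g ≈ g
  ⊛-identityˡ g zero    = ℤP.*-identityˡ (g 0)
  ⊛-identityˡ g (suc n) =
    trans (cong₂ _+_ (ℤP.*-identityˡ (g (suc n))) (⊛-zeroˡ g n)) (ℤP.+-identityʳ _)

  private
    interchange : ∀ a b c d → (a + b) + (c + d) ≡ (a + c) + (b + d)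
    interchange = solve-∀

  ⊛-distribʳ : ∀ f g h → (g ⊕ h) ⊛ f ≈ (g ⊛ f) ⊕ (h ⊛ f)
  ⊛-distribʳ f g h zero    = ℤP.*-distribʳ-+ (f 0) (g 0) (h 0)
  ⊛-distribʳ f g h (suc n) =
    trans (cong₂ _+_ (ℤP.*-distribʳ-+ (f (suc n)) (g 0) (h 0)) (⊛-distribʳ f (tail g) (tail h) n))
          (interchange (g 0 * f (suc n)) (h 0 * f (suc n)) ((tail g ⊛ f) n) ((tail h ⊛ f) n))

  ⊛-distribˡ : ∀ f g h → f ⊛ (g ⊕ h) ≈ (f ⊛ g) ⊕ (f ⊛ h)
  ⊛-distribˡ f g h zero    = ℤP.*-distribˡ-+ (f 0) (g 0) (h 0)
  ⊛-distribˡ f g h (suc n) =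
    trans (cong₂ _+_ (ℤP.*-distribˡ-+ (f 0) (g (suc n)) (h (suc n))) (⊛-distribˡ (tail f) g h n))
          (interchange (f 0 * g (suc n)) (f 0 * h (suc n)) ((tail f ⊛ g) n) ((tail f ⊛ h) n))

  ⊛-scaleˡ : ∀ c f g → scale c f ⊛ g ≈ scale c (f ⊛ g)
  ⊛-scaleˡ c f g zero    = ℤP.*-assoc c (f 0) (g 0)
  ⊛-scaleˡ c f g (suc n) =
    trans (cong₂ _+_ (ℤP.*-assoc c (f 0) (g (suc n))) (⊛-scaleˡ c (tail f) g n))
          (sym (ℤP.*-distribˡ-+ c _ _))

  ⊛-sucʳ : ∀ f g n → (f ⊛ g) (suc n) ≡ (f ⊛ tail g) n + f (suc n) * g 0
  ⊛-sucʳ f g zero    = refl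
  ⊛-sucʳ f g (suc n) =
    trans (cong (f 0 * g (suc (suc n)) +_) (⊛-sucʳ (tail f) g n))
          (sym (ℤP.+-assoc (f 0 * g (suc (suc n))) ((tail f ⊛ tail g) n) (tail f (suc n) * g 0)))

  ⊛-comm : ∀ f g → f ⊛ g ≈ g ⊛ f
  ⊛-comm f g zero    = ℤP.*-comm (f 0) (g 0)
  ⊛-comm f g (suc n) =
    trans (cong₂ _+_ (ℤP.*-comm (f 0) (g (suc n))) (⊛-comm (tail f) g n))
          (trans (ℤP.+-comm (g (suc n) * f 0) ((g ⊛ tail f) n)) (sym (⊛-sucʳ g f n)))

  ⊛-scaleʳ : ∀ c f g → f ⊛ scale c g ≈ scale c (f ⊛ g)
  ⊛-scaleʳ c f g n =
    trans (⊛-comm f (scale c g) n) (trans (⊛-scaleˡ c g f n) (cong (c *_) (⊛-comm g f n)))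

  ⊛-assoc : ∀ f g h → (f ⊛ g) ⊛ h ≈ f ⊛ (g ⊛ h)
  ⊛-assoc f g h zero    = ℤP.*-assoc (f 0) (g 0) (h 0)
  ⊛-assoc f g h (suc n) = begin
      (f 0 * g 0) * h (suc n) + (tail (f ⊛ g) ⊛ h) n
    ≡⟨ cong ((f 0 * g 0) * h (suc n) +_) (⊛-distribʳ h (scale (f 0) (tail g)) (tail f ⊛ g) n) ⟩
      (f 0 * g 0) * h (suc n) + ((scale (f 0) (tail g) ⊛ h) n + ((tail f ⊛ g) ⊛ h) n)
    ≡⟨ cong₂ (λ a b → (f 0 * g 0) * h (suc n) + (a + b)) (⊛-scaleˡ (f 0) (tail g) h n) (⊛-assoc (tail f) g h n) ⟩
      (f 0 * g 0) * h (suc n) + (f 0 * (tail g ⊛ h) n + (tail f ⊛ (g ⊛ h)) n)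
    ≡⟨ regroup (f 0) (g 0) (h (suc n)) _ _ ⟩
      f 0 * (g 0 * h (suc n) + (tail g ⊛ h) n) + (tail f ⊛ (g ⊛ h)) n
    ∎
    where
    open ≡-Reasoning
    regroup : ∀ a b c d e → (a * b) * c + (a * d + e) ≡ a * (b * c + d) + e
    regroup = solve-∀

  commutativeRing : CommutativeRing 0ℓ 0ℓ
  commutativeRing = record
    { Carrier = Series ; _≈_ = _≈_ ; _+_ = _⊕_ ; _*_ = _⊛_ ; -_ = ⊝_ ; 0# = 0s ; 1# = 1s
    ; isCommutativeRing = record
      { isRing = record
        { +-isAbelianGroup = record
          { isGroup = record
            { isMonoid = record
              { isSemigroup = record
                { isMagma = record { isEquivalence = ≈-isEquivalence ; ∙-cong = ⊕-cong }
                ; assoc = λ f g h n → ℤP.+-assoc (f n) (g n) (h n) }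
              ; identity = (λ f n → ℤP.+-identityˡ (f n)) , (λ f n → ℤP.+-identityʳ (f n)) }
            ; inverse = (λ f n → ℤP.+-inverseˡ (f n)) , (λ f n → ℤP.+-inverseʳ (f n))
            ; ⁻¹-cong = λ e n → cong -_ (e n) }
          ; comm = λ f g n → ℤP.+-comm (f n) (g n) }
        ; *-cong = ⊛-cong
        ; *-assoc = ⊛-assoc
        ; *-identity = ⊛-identityˡ , (λ f → ≈-trans (⊛-comm f 1s) (⊛-identityˡ f))
        ; distrib = ⊛-distribˡ , ⊛-distribʳ }
      ; *-comm = ⊛-comm } }

  open CommutativeRing commutativeRing public using (semiring; commutativeSemiring)
  module ≈-Reasoning = Relation.Binary.Reasoning.Setoid (CommutativeRing.setoid commutativeRing)
  open import Algebra.Properties.Semiring.Exp semiring public using (_^_; ^-homo-*; ^-congˡ)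

  ^2≈⊛ : ∀ f → f ^ 2 ≈ f ⊛ f
  ^2≈⊛ f = ⊛-congˡ {f} (≈-trans (⊛-comm f 1s) (⊛-identityˡ f))

  ^-≡ : ∀ f {a b} → a ≡ b → f ^ a ≈ f ^ b
  ^-≡ f refl = ≈-refl

  X : Series
  X (suc zero) = 1ℤ
  X _          = 0ℤ

  shift : Series → Series
  shift f zero    = 0ℤ
  shift f (suc n) = f n

  shiftBy : ℕ → Series → Series
  shiftBy zero    f = f
  shiftBy (suc j) f = shift (shiftBy j f)

  shift-cong : ∀ {f g} → f ≈ g → shift f ≈ shift g
  shift-cong e zero    = refl
  shift-cong e (suc n) = e n

  shiftBy-cong : ∀ k {f g} → f ≈ g → shiftBy k f ≈ shiftBy k g
  shiftBy-cong zero    e = e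
  shiftBy-cong (suc k) e = shift-cong (shiftBy-cong k e)

  shiftBy-+ : ∀ j f i → shiftBy j f (j ℕ.+ i) ≡ f i
  shiftBy-+ zero    f i = refl
  shiftBy-+ (suc j) f i = shiftBy-+ j f i

  shiftBy-< : ∀ j f i → i < j → shiftBy j f i ≡ 0ℤ
  shiftBy-< (suc j) f zero    _         = refl
  shiftBy-< (suc j) f (suc i) (s≤s i<j) = shiftBy-< j f i i<j

  X⊛ : ∀ f → X ⊛ f ≈ shift f
  X⊛ f zero    = refl
  X⊛ f (suc n) =
    trans (cong (_+ (tail X ⊛ f) n) (ℤP.*-zeroˡ (f (suc n))))
          (trans (ℤP.+-identityˡ _) (trans (⊛-congʳ tail-X n) (⊛-identityˡ f n)))
    where
    tail-X : tail X ≈ 1s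
    tail-X zero    = refl
    tail-X (suc k) = refl

  X^⊛ : ∀ j f → X ^ j ⊛ f ≈ shiftBy j f
  X^⊛ zero    f = ⊛-identityˡ f
  X^⊛ (suc j) f = ≈-trans (⊛-assoc X (X ^ j) f) (≈-trans (X⊛ (X ^ j ⊛ f)) (shift-cong (X^⊛ j f)))

  shift-⊛ : ∀ f g → shift f ⊛ g ≈ f ⊛ shift g
  shift-⊛ f g = begin
      shift f ⊛ g    ≈⟨ ⊛-congʳ (≈-sym (X⊛ f)) ⟩
      (X ⊛ f) ⊛ g    ≈⟨ ⊛-congʳ (⊛-comm X f) ⟩
      (f ⊛ X) ⊛ g    ≈⟨ ⊛-assoc f X g ⟩
      f ⊛ (X ⊛ g)    ≈⟨ ⊛-congˡ (X⊛ g) ⟩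
      f ⊛ shift g    ∎
    where open ≈-Reasoning

  ⊛-shiftBy : ∀ k f g → f ⊛ shiftBy k g ≈ shiftBy k (f ⊛ g)
  ⊛-shiftBy k f g = begin
      f ⊛ shiftBy k g      ≈⟨ ⊛-congˡ (≈-sym (X^⊛ k g)) ⟩
      f ⊛ (X ^ k ⊛ g)      ≈⟨ ≈-sym (⊛-assoc f (X ^ k) g) ⟩
      (f ⊛ X ^ k) ⊛ g      ≈⟨ ⊛-congʳ (⊛-comm f (X ^ k)) ⟩
      (X ^ k ⊛ f) ⊛ g      ≈⟨ ⊛-assoc (X ^ k) f g ⟩
      X ^ k ⊛ (f ⊛ g)      ≈⟨ X^⊛ k (f ⊛ g) ⟩
      shiftBy k (f ⊛ g)    ∎
    where open ≈-Reasoning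

  ⊛-shiftBy-+ : ∀ k f g j → (f ⊛ shiftBy k g) (k ℕ.+ j) ≡ (f ⊛ g) j
  ⊛-shiftBy-+ k f g j = trans (⊛-shiftBy k f g (k ℕ.+ j)) (shiftBy-+ k (f ⊛ g) j)

  ⊛-head : ∀ f g n → (f ⊛ g) n ≡ f 0 * g n + (shift (tail f) ⊛ g) n
  ⊛-head f g zero    = sym (trans (cong (f 0 * g 0 +_) (ℤP.*-zeroˡ (g 0))) (ℤP.+-identityʳ _))
  ⊛-head f g (suc n) =
    cong (f 0 * g (suc n) +_)
         (sym (trans (cong (_+ (tail f ⊛ g) n) (ℤP.*-zeroˡ (g (suc n)))) (ℤP.+-identityˡ _)))


module FiniteSum where

  open import Data.Nat as ℕ using (ℕ; zero; suc; _<_; _≤_; s≤s; z≤n)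
  import Data.Nat.Properties as ℕP
  open import Data.Integer using (ℤ; +_; 0ℤ; _+_; _*_; -_; _-_)
  import Data.Integer.Properties as ℤP
  open import Data.Integer.Tactic.RingSolver using (solve-∀)
  open import Function using (_∘_)
  open import Relation.Binary.PropositionalEquality

  Σ< : (ℕ → ℤ) → ℕ → ℤ
  Σ< g zero    = 0ℤ
  Σ< g (suc N) = g 0 + Σ< (g ∘ suc) N

  Σ<-cong< : ∀ {g h} N → (∀ k → k < N → g k ≡ h k) → Σ< g N ≡ Σ< h N
  Σ<-cong< zero    e = refl
  Σ<-cong< (suc N) e = cong₂ _+_ (e 0 (s≤s z≤n)) (Σ<-cong< N (λ k k<N → e (suc k) (s≤s k<N)))

  Σ<-cong : ∀ {g h} N → (∀ k → g k ≡ h k) → Σ< g N ≡ Σ< h N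
  Σ<-cong N e = Σ<-cong< N (λ k _ → e k)

  Σ<-suc : ∀ g N → Σ< g (suc N) ≡ Σ< g N + g N
  Σ<-suc g zero    = ℤP.+-comm (g 0) 0ℤ
  Σ<-suc g (suc N) = trans (cong (_+_ (g 0)) (Σ<-suc (g ∘ suc) N)) (sym (ℤP.+-assoc (g 0) _ _))

  Σ<-+ : ∀ g h N → Σ< (λ k → g k + h k) N ≡ Σ< g N + Σ< h N
  Σ<-+ g h zero    = refl
  Σ<-+ g h (suc N) = trans (cong (_+_ (g 0 + h 0)) (Σ<-+ (g ∘ suc) (h ∘ suc) N)) (interchange (g 0) (h 0) _ _)
    where
    interchange : ∀ a b c d → (a + b) + (c + d) ≡ (a + c) + (b + d)
    interchange = solve-∀

  Σ<-*ˡ : ∀ c g N → Σ< (λ k → c * g k) N ≡ c * Σ< g N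
  Σ<-*ˡ c g zero    = sym (ℤP.*-zeroʳ c)
  Σ<-*ˡ c g (suc N) = trans (cong (_+_ (c * g 0)) (Σ<-*ˡ c (g ∘ suc) N)) (sym (ℤP.*-distribˡ-+ c (g 0) _))

  Σ<-neg : ∀ g N → Σ< (λ k → - g k) N ≡ - Σ< g N
  Σ<-neg g zero    = refl
  Σ<-neg g (suc N) = trans (cong (_+_ (- g 0)) (Σ<-neg (g ∘ suc) N)) (sym (ℤP.neg-distrib-+ (g 0) _))

  Σ<-- : ∀ g h N → Σ< (λ k → g k - h k) N ≡ Σ< g N - Σ< h N
  Σ<-- g h N = trans (Σ<-+ g (λ k → - h k) N) (cong (_+_ (Σ< g N)) (Σ<-neg h N))

  Σ<-const : ∀ c N → Σ< (λ _ → + c) N ≡ + (N ℕ.* c)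
  Σ<-const c zero    = refl
  Σ<-const c (suc N) = trans (cong (_+_ (+ c)) (Σ<-const c N)) (sym (ℤP.pos-+ c (N ℕ.* c)))

  Σ<-zero : ∀ g N → (∀ k → k < N → g k ≡ 0ℤ) → Σ< g N ≡ 0ℤ
  Σ<-zero g N e = trans (Σ<-cong< N e) (trans (Σ<-const 0 N) (cong +_ (ℕP.*-zeroʳ N)))

  Σ<-extend : ∀ g N d → (∀ k → N ≤ k → g k ≡ 0ℤ) → Σ< g (d ℕ.+ N) ≡ Σ< g N
  Σ<-extend g N zero    e = refl
  Σ<-extend g N (suc d) e =
    trans (Σ<-suc g (d ℕ.+ N))
          (trans (cong₂ _+_ (Σ<-extend g N d e) (e (d ℕ.+ N) (ℕP.m≤n+m N d))) (ℤP.+-identityʳ _))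

  Σ<-evens-odds : ∀ g N → Σ< g (N ℕ.+ N) ≡ Σ< (λ j → g (j ℕ.+ j)) N + Σ< (λ j → g (suc (j ℕ.+ j))) N
  Σ<-evens-odds g zero    = refl
  Σ<-evens-odds g (suc N) = begin
      Σ< g (suc N ℕ.+ suc N)
    ≡⟨ cong (Σ< g ∘ suc) (ℕP.+-suc N N) ⟩
      Σ< g (suc (suc (N ℕ.+ N)))
    ≡⟨ trans (Σ<-suc g (suc (N ℕ.+ N))) (cong (_+ o N) (Σ<-suc g (N ℕ.+ N))) ⟩
      Σ< g (N ℕ.+ N) + e N + o N
    ≡⟨ cong (λ z → z + e N + o N) (Σ<-evens-odds g N) ⟩
      Σ< e N + Σ< o N + e N + o N
    ≡⟨ regroup (Σ< e N) (Σ< o N) (e N) (o N) ⟩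
      (Σ< e N + e N) + (Σ< o N + o N)
    ≡⟨ sym (cong₂ _+_ (Σ<-suc e N) (Σ<-suc o N)) ⟩
      Σ< e (suc N) + Σ< o (suc N)
    ∎
    where
    open ≡-Reasoning
    e o : ℕ → ℤ
    e j = g (j ℕ.+ j)
    o j = g (suc (j ℕ.+ j))
    regroup : ∀ a b c d → a + b + c + d ≡ (a + c) + (b + d)
    regroup = solve-∀

  Σ<-single : ∀ g N a → a < N → (∀ k → k < N → k ≢ a → g k ≡ 0ℤ) → Σ< g N ≡ g a
  Σ<-single g (suc N) zero _ e =
    trans (cong (_+_ (g 0)) (Σ<-zero (g ∘ suc) N (λ k k<N → e (suc k) (s≤s k<N) (λ ()))))
          (ℤP.+-identityʳ (g 0))
  Σ<-single g (suc N) (suc a) (s≤s a<N) e =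
    trans (cong (_+ Σ< (g ∘ suc) N) (e 0 (s≤s z≤n) (λ ())))
          (trans (ℤP.+-identityˡ _)
                 (Σ<-single (g ∘ suc) N a a<N
                   (λ k k<N k≢a → e (suc k) (s≤s k<N) (k≢a ∘ ℕP.suc-injective))))


module BinaryDigits where

  open import Data.Bool using (Bool; true; false)
  open import Data.Nat as ℕ using (ℕ; zero; suc; _≤_; _<_; z≤n; s≤s; ⌊_/2⌋)
  import Data.Nat.Properties as ℕP
  open import Data.Nat.Induction using (<-rec)
  open import Data.Nat.Logarithm using (⌈log₂_⌉; ⌈log₂⌉-mono-≤; ⌈log₂2*n⌉≡1+⌈log₂n⌉)
  open import Data.Nat.Tactic.RingSolver using (solve-∀)
  open import Data.Product using (_×_; _,_; proj₁)
  open import Function using (_∘_)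
  open import Relation.Binary.PropositionalEquality

  data EvenOdd : ℕ → Set where
    even : ∀ N → EvenOdd (N ℕ.+ N)
    odd  : ∀ N → EvenOdd (suc (N ℕ.+ N))

  evenOdd : ∀ i → EvenOdd i
  evenOdd zero = even 0
  evenOdd (suc i) with evenOdd i
  ... | even N = odd N
  ... | odd N  = subst EvenOdd (cong suc (ℕP.+-suc N N)) (even (suc N))

  binary-induction : (Q : ℕ → Set) → Q 0 →
                     (∀ N → Q (suc N) → Q (suc N ℕ.+ suc N)) → (∀ N → Q N → Q (suc (N ℕ.+ N))) →
                     ∀ n → Q n
  binary-induction Q q₀ q-even q-odd = <-rec Q step
    where
    step : ∀ n → (∀ {m} → m < n → Q m) → Q n
    step n rec with evenOdd n
    ... | even zero    = q₀
    ... | even (suc N) = q-even N (rec (ℕP.m<m+n (suc N) (s≤s z≤n)))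
    ... | odd N        = q-odd N (rec (s≤s (ℕP.m≤m+n N N)))

  bit : Bool → ℕ
  bit false = 0
  bit true  = 1

  2*N+0≡N+N : ∀ N → 2 ℕ.* N ℕ.+ 0 ≡ N ℕ.+ N
  2*N+0≡N+N = solve-∀

  2*N+1≡1+N+N : ∀ N → 2 ℕ.* N ℕ.+ 1 ≡ suc (N ℕ.+ N)
  2*N+1≡1+N+N = solve-∀

  isOdd : ℕ → Bool
  isOdd zero          = false
  isOdd (suc zero)    = true
  isOdd (suc (suc n)) = isOdd n

  isOdd-even : ∀ N → isOdd (N ℕ.+ N) ≡ false
  isOdd-even zero    = refl
  isOdd-even (suc N) = trans (cong (isOdd ∘ suc) (ℕP.+-suc N N)) (isOdd-even N)

  isOdd-odd : ∀ N → isOdd (suc (N ℕ.+ N)) ≡ true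
  isOdd-odd zero    = refl
  isOdd-odd (suc N) = trans (cong (isOdd ∘ suc ∘ suc) (ℕP.+-suc N N)) (isOdd-odd N)

  ⌊1+2N/2⌋≡N : ∀ N → ⌊ suc (N ℕ.+ N) /2⌋ ≡ N
  ⌊1+2N/2⌋≡N N = sym (ℕP.n≡⌈n+n/2⌉ N)

  module _ {A : Set} (a : A) (g : Bool → A → A) where

    private
      go : ℕ → ℕ → A
      go zero    _       = a
      go (suc f) zero    = a
      go (suc f) (suc m) = g (isOdd (suc m)) (go f ⌊ suc m /2⌋)

      go-fuel : ∀ f f′ n → n ≤ f → n ≤ f′ → go f n ≡ go f′ n
      go-fuel zero    zero     n       _         _          = refl
      go-fuel zero    (suc f′) zero    _         _          = refl
      go-fuel (suc f) zero     zero    _         _          = refl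
      go-fuel (suc f) (suc f′) zero    _         _          = refl
      go-fuel (suc f) (suc f′) (suc m) (s≤s m≤f) (s≤s m≤f′) =
        cong (g (isOdd (suc m))) (go-fuel f f′ ⌊ suc m /2⌋ (ℕP.≤-trans h≤m m≤f) (ℕP.≤-trans h≤m m≤f′))
        where
        h≤m : ⌊ suc m /2⌋ ≤ m
        h≤m = ℕP.≤-pred (ℕP.⌊n/2⌋<n m)

    foldBits : ℕ → A
    foldBits n = go n n

    foldBits-suc : ∀ m → foldBits (suc m) ≡ g (isOdd (suc m)) (foldBits ⌊ suc m /2⌋)
    foldBits-suc m =
      cong (g (isOdd (suc m))) (go-fuel m ⌊ suc m /2⌋ ⌊ suc m /2⌋ (ℕP.≤-pred (ℕP.⌊n/2⌋<n m)) ℕP.≤-refl)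

    foldBits-odd : ∀ N → foldBits (suc (N ℕ.+ N)) ≡ g true (foldBits N)
    foldBits-odd N = trans (foldBits-suc (N ℕ.+ N)) (cong₂ g (isOdd-odd N) (cong foldBits (⌊1+2N/2⌋≡N N)))

    foldBits-even-suc : ∀ N → foldBits (suc N ℕ.+ suc N) ≡ g false (foldBits (suc N))
    foldBits-even-suc N =
      trans (cong foldBits (cong suc (ℕP.+-suc N N)))
            (trans (foldBits-suc (suc (N ℕ.+ N)))
                   (cong₂ g (trans (cong isOdd (sym (cong suc (ℕP.+-suc N N)))) (isOdd-even (suc N)))
                            (cong (foldBits ∘ suc) (sym (ℕP.n≡⌊n+n/2⌋ N)))))

    foldBits-even : g false a ≡ a → ∀ N → foldBits (N ℕ.+ N) ≡ g false (foldBits N)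
    foldBits-even g₀a≡a zero    = sym g₀a≡a
    foldBits-even g₀a≡a (suc N) = foldBits-even-suc N

  bitLength : ℕ → ℕ
  bitLength n = ⌈log₂ suc n ⌉

  bitLength-mono : ∀ {m n} → m ≤ n → bitLength m ≤ bitLength n
  bitLength-mono m≤n = ⌈log₂⌉-mono-≤ (s≤s m≤n)

  bitLength-odd : ∀ N → bitLength (suc (N ℕ.+ N)) ≡ suc (bitLength N)
  bitLength-odd N = trans (cong ⌈log₂_⌉ (2+2N≡2*[1+N] N)) (⌈log₂2*n⌉≡1+⌈log₂n⌉ (suc N))
    where
    2+2N≡2*[1+N] : ∀ N → suc (suc (N ℕ.+ N)) ≡ 2 ℕ.* suc N
    2+2N≡2*[1+N] = solve-∀

  bitLength-even : ∀ N → bitLength (N ℕ.+ N) ≤ suc (bitLength N)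
  bitLength-even N = ℕP.≤-trans (bitLength-mono (ℕP.n≤1+n (N ℕ.+ N))) (ℕP.≤-reflexive (bitLength-odd N))

  bitLength-pos : ∀ {n} → 1 ≤ n → 1 ≤ bitLength n
  bitLength-pos {n} = bitLength-mono {1} {n}

  private
    1+b-squared : ∀ b k → b ℕ.* b ≤ 4 ℕ.* k → b ≤ k → suc b ℕ.* suc b ≤ 6 ℕ.* k ℕ.+ 1
    1+b-squared b k b²≤4k b≤k = begin
        suc b ℕ.* suc b                  ≡⟨ expand b ⟩
        b ℕ.* b ℕ.+ 2 ℕ.* b ℕ.+ 1        ≤⟨ ℕP.+-monoˡ-≤ 1 (ℕP.+-mono-≤ b²≤4k (ℕP.*-monoʳ-≤ 2 b≤k)) ⟩
        4 ℕ.* k ℕ.+ 2 ℕ.* k ℕ.+ 1        ≡⟨ collect k ⟩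
        6 ℕ.* k ℕ.+ 1                    ∎
      where
      open ℕP.≤-Reasoning
      expand : ∀ b → suc b ℕ.* suc b ≡ b ℕ.* b ℕ.+ 2 ℕ.* b ℕ.+ 1
      expand = solve-∀
      collect : ∀ k → 4 ℕ.* k ℕ.+ 2 ℕ.* k ℕ.+ 1 ≡ 6 ℕ.* k ℕ.+ 1
      collect = solve-∀

    SquareBound : ℕ → Set
    SquareBound n = bitLength n ℕ.* bitLength n ≤ 4 ℕ.* n × bitLength n ≤ n

    square-bound : ∀ n → SquareBound n
    square-bound = binary-induction SquareBound (z≤n , z≤n) even-step odd-step
      where
      even-step : ∀ N → SquareBound (suc N) → SquareBound (suc N ℕ.+ suc N)
      even-step N (sq , le) =
        ℕP.≤-trans (ℕP.*-mono-≤ bl≤ bl≤)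
                   (ℕP.≤-trans (1+b-squared _ _ sq le) (final N)) ,
        ℕP.≤-trans bl≤ (s≤s (ℕP.≤-trans le (ℕP.m≤n+m (suc N) N)))
        where
        bl≤ = bitLength-even (suc N)
        final : ∀ N → 6 ℕ.* suc N ℕ.+ 1 ≤ 4 ℕ.* (suc N ℕ.+ suc N)
        final N = subst (6 ℕ.* suc N ℕ.+ 1 ≤_) (sym (split N)) (ℕP.m≤m+n _ _)
          where
          split : ∀ N → 4 ℕ.* (suc N ℕ.+ suc N) ≡ (6 ℕ.* suc N ℕ.+ 1) ℕ.+ (2 ℕ.* N ℕ.+ 1)
          split = solve-∀
      odd-step : ∀ N → SquareBound N → SquareBound (suc (N ℕ.+ N))
      odd-step N (sq , le) =
        subst (λ b → b ℕ.* b ≤ 4 ℕ.* suc (N ℕ.+ N) × b ≤ suc (N ℕ.+ N)) (sym (bitLength-odd N))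
              (ℕP.≤-trans (1+b-squared _ _ sq le) (final N) , s≤s (ℕP.≤-trans le (ℕP.m≤m+n N N)))
        where
        final : ∀ N → 6 ℕ.* N ℕ.+ 1 ≤ 4 ℕ.* suc (N ℕ.+ N)
        final N = subst (6 ℕ.* N ℕ.+ 1 ≤_) (sym (split N)) (ℕP.m≤m+n _ _)
          where
          split : ∀ N → 4 ℕ.* suc (N ℕ.+ N) ≡ (6 ℕ.* N ℕ.+ 1) ℕ.+ (2 ℕ.* N ℕ.+ 3)
          split = solve-∀

  bitLength² : ∀ n → bitLength n ℕ.* bitLength n ≤ 4 ℕ.* n
  bitLength² n = proj₁ (square-bound n)


module Catalan where

  open import Data.Nat
  open import Data.Nat.Properties
  open import Data.Nat.Combinatorics
  open import Data.Nat.DivMod using (m*n/n≡m)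
  open import Data.Nat.Tactic.RingSolver using (solve-∀)
  open import Relation.Binary.PropositionalEquality
  open import Defs using (catalan)

  [1+k]*[1+n]C[1+k]≡[1+n]*nCk : ∀ n k → suc k * (suc n C suc k) ≡ suc n * (n C k)
  [1+k]*[1+n]C[1+k]≡[1+n]*nCk zero zero    = refl
  [1+k]*[1+n]C[1+k]≡[1+n]*nCk zero (suc k) =
    trans (cong (suc (suc k) *_) (k>n⇒nCk≡0 {1} {suc (suc k)} (s≤s (s≤s z≤n))))
          (trans (*-zeroʳ (suc (suc k))) (sym (k>n⇒nCk≡0 {0} {suc k} (s≤s z≤n))))
  [1+k]*[1+n]C[1+k]≡[1+n]*nCk (suc n) zero =
    trans (*-identityˡ _) (trans (nC1≡n (suc (suc n))) (sym (*-identityʳ _)))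
  [1+k]*[1+n]C[1+k]≡[1+n]*nCk (suc n) (suc k) = begin
      suc (suc k) * (suc (suc n) C suc (suc k))
    ≡⟨ cong (suc (suc k) *_) (sym (nCk+nC[k+1]≡[n+1]C[k+1] (suc n) (suc k))) ⟩
      suc (suc k) * (a + b)
    ≡⟨ expand (suc k) a b ⟩
      suc k * a + a + suc (suc k) * b
    ≡⟨ cong₂ (λ u v → u + a + v) ([1+k]*[1+n]C[1+k]≡[1+n]*nCk n k) ([1+k]*[1+n]C[1+k]≡[1+n]*nCk n (suc k)) ⟩
      suc n * (n C k) + a + suc n * (n C suc k)
    ≡⟨ collect (suc n) (n C k) a (n C suc k) ⟩
      suc n * (n C k + n C suc k) + a
    ≡⟨ cong (λ u → suc n * u + a) (nCk+nC[k+1]≡[n+1]C[k+1] n k) ⟩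
      suc n * a + a
    ≡⟨ +-comm (suc n * a) a ⟩
      suc (suc n) * a
    ∎
    where
    open ≡-Reasoning
    a = suc n C suc k
    b = suc n C suc (suc k)
    expand : ∀ k a b → suc k * (a + b) ≡ k * a + a + suc k * b
    expand = solve-∀
    collect : ∀ m x a y → m * x + a + m * y ≡ m * (x + y) + a
    collect = solve-∀

  [1+k]*2kC[1+k]≡k*2kCk : ∀ k → suc k * ((2 * k) C suc k) ≡ k * ((2 * k) C k)
  [1+k]*2kC[1+k]≡k*2kCk zero    = refl
  [1+k]*2kC[1+k]≡k*2kCk (suc j) = begin
      suc (suc j) * (2 * suc j C suc (suc j))
    ≡⟨ cong (λ z → suc (suc j) * (z C suc (suc j))) 2[1+j]≡2+2j ⟩
      suc (suc j) * (suc m C suc (suc j))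
    ≡⟨ [1+k]*[1+n]C[1+k]≡[1+n]*nCk m (suc j) ⟩
      suc m * (m C suc j)
    ≡⟨ cong (suc m *_) mC[1+j]≡mCj ⟩
      suc m * (m C j)
    ≡⟨ sym ([1+k]*[1+n]C[1+k]≡[1+n]*nCk m j) ⟩
      suc j * (suc m C suc j)
    ≡⟨ cong (λ z → suc j * (z C suc j)) (sym 2[1+j]≡2+2j) ⟩
      suc j * (2 * suc j C suc j)
    ∎
    where
    open ≡-Reasoning
    m = suc (2 * j)
    2[1+j]≡2+2j : 2 * suc j ≡ suc m
    2[1+j]≡2+2j = cong suc (+-suc j (j + 0))
    2j≡j+j : 2 * j ≡ j + j
    2j≡j+j = cong (j +_) (+-identityʳ j)
    mC[1+j]≡mCj : m C suc j ≡ m C j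
    mC[1+j]≡mCj = trans (nCk≡nC[n∸k] (s≤s (subst (j ≤_) (sym 2j≡j+j) (m≤m+n j j))))
                        (cong (m C_) (trans (cong (_∸ j) 2j≡j+j) (m+n∸m≡n j j)))

  catalan+2kC[1+k]≡2kCk : ∀ k → catalan k + (2 * k) C suc k ≡ (2 * k) C k
  catalan+2kC[1+k]≡2kCk k = trans (cong (_+ b) catalan≡a∸b) (m∸n+n≡m b≤a)
    where
    a = (2 * k) C k
    b = (2 * k) C suc k
    key = [1+k]*2kC[1+k]≡k*2kCk k
    b≤a : b ≤ a
    b≤a = *-cancelˡ-≤ (suc k) (subst (_≤ suc k * a) (sym key) (*-monoˡ-≤ a (n≤1+n k)))
    [a∸b]*[1+k]≡a : (a ∸ b) * suc k ≡ a
    [a∸b]*[1+k]≡a = begin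
        (a ∸ b) * suc k            ≡⟨ *-distribʳ-∸ (suc k) a b ⟩
        a * suc k ∸ b * suc k      ≡⟨ cong₂ _∸_ (*-comm a (suc k)) (*-comm b (suc k)) ⟩
        suc k * a ∸ suc k * b      ≡⟨ cong (suc k * a ∸_) key ⟩
        (a + k * a) ∸ k * a        ≡⟨ m+n∸n≡m a (k * a) ⟩
        a                          ∎
      where open ≡-Reasoning
    catalan≡a∸b : catalan k ≡ a ∸ b
    catalan≡a∸b = trans (cong (_/ suc k) (sym [a∸b]*[1+k]≡a)) (m*n/n≡m (a ∸ b) (suc k))


module Trinomial where

  open import Data.Nat as ℕ using (ℕ; zero; suc; _<_; _≤_; s≤s; _∸_; ⌊_/2⌋)
  import Data.Nat.Properties as ℕP
  open import Data.Nat.Combinatorics using (_C_; k>n⇒nCk≡0)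
  open import Data.Nat.Tactic.RingSolver as ℕ-Solver using ()
  open import Data.Integer using (ℤ; +_; 0ℤ; 1ℤ; _+_; _*_; -_; _-_)
  import Data.Integer.Properties as ℤP
  open import Data.Integer.Tactic.RingSolver using (solve-∀)
  open import Data.Fin using (toℕ)
  open import Relation.Binary.Definitions using (tri<; tri≈; tri>)
  open import Relation.Nullary using (yes; no)
  open import Data.Empty using (⊥-elim)
  open import Function using (_∘_)
  open import Relation.Binary.PropositionalEquality
  open import Algebra.Definitions.RawSemiring using (sum; _×_)
  import Algebra.Properties.CommutativeSemiring.Binomial as Binomial
  open import Defs using (catalan; sumTo; motzkin)

  open PowerSeries
  open FiniteSum
  open Catalan using (catalan+2kC[1+k]≡2kCk)
  open Binomial commutativeSemiring using (binomialExpansion) renaming (theorem to binomial-theorem)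
  open import Algebra.Bundles using (Semiring)
  open Semiring semiring using (rawSemiring)

  sum-coeff : ∀ N (w : ℕ → Series) i → sum rawSemiring {N} (w ∘ toℕ) i ≡ Σ< (λ k → w k i) N
  sum-coeff zero    w i = refl
  sum-coeff (suc N) w i = cong (_+_ (w 0 i)) (sum-coeff N (w ∘ suc) i)

  ×-coeff : ∀ c f i → _×_ rawSemiring c f i ≡ + c * f i
  ×-coeff zero    f i = sym (ℤP.*-zeroˡ (f i))
  ×-coeff (suc c) f i =
    trans (cong (_+_ (f i)) (×-coeff c f i))
          (sym (trans (ℤP.*-distribʳ-+ (f i) (+ 1) (+ c)) (cong (_+ + c * f i) (ℤP.*-identityˡ (f i)))))

  binomialExpansion-coeff : ∀ f g n i →
    binomialExpansion f g n i ≡ Σ< (λ k → + (n C k) * (f ^ k ⊛ g ^ (n ∸ k)) i) (suc n)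
  binomialExpansion-coeff f g n i =
    trans (sum-coeff (suc n) (λ k → _×_ rawSemiring (n C k) (f ^ k ⊛ g ^ (n ∸ k))) i)
          (Σ<-cong (suc n) (λ k → ×-coeff (n C k) (f ^ k ⊛ g ^ (n ∸ k)) i))

  1s^ : ∀ m → 1s ^ m ≈ 1s
  1s^ zero    = ≈-refl
  1s^ (suc m) = ≈-trans (⊛-identityˡ (1s ^ m)) (1s^ m)

  X² : Series
  X² = X ⊛ X

  X²^⊛ : ∀ l f → X² ^ l ⊛ f ≈ shiftBy (l ℕ.+ l) f
  X²^⊛ zero    f = ⊛-identityˡ f
  X²^⊛ (suc l) f = begin
      (X² ⊛ X² ^ l) ⊛ f                        ≈⟨ ⊛-assoc X² (X² ^ l) f ⟩
      (X ⊛ X) ⊛ (X² ^ l ⊛ f)                   ≈⟨ ⊛-assoc X X (X² ^ l ⊛ f) ⟩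
      X ⊛ (X ⊛ (X² ^ l ⊛ f))                   ≈⟨ ≈-trans (X⊛ _) (shift-cong (X⊛ _)) ⟩
      shift (shift (X² ^ l ⊛ f))               ≈⟨ shift-cong (shift-cong (X²^⊛ l f)) ⟩
      shiftBy (suc (suc (l ℕ.+ l))) f          ≡⟨ cong (λ k → shiftBy (suc k) f) (sym (ℕP.+-suc l l)) ⟩
      shiftBy (suc l ℕ.+ suc l) f              ∎
    where open ≈-Reasoning

  1+X² : Series
  1+X² = X² ⊕ 1s

  shiftBy-1s-≡ : ∀ j → shiftBy j 1s j ≡ 1ℤ
  shiftBy-1s-≡ j = subst (λ z → shiftBy j 1s z ≡ 1ℤ) (ℕP.+-identityʳ j) (shiftBy-+ j 1s 0)

  shiftBy-1s-≢ : ∀ j i → j ≢ i → shiftBy j 1s i ≡ 0ℤ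
  shiftBy-1s-≢ j i j≢i with ℕP.<-cmp i j
  ... | tri< i<j _ _ = shiftBy-< j 1s i i<j
  ... | tri≈ _ i≡j _ = ⊥-elim (j≢i (sym i≡j))
  ... | tri> _ _ j<i =
    trans (cong (shiftBy j 1s) (sym (ℕP.m+[n∸m]≡n (ℕP.<⇒≤ j<i))))
          (trans (shiftBy-+ j 1s (i ∸ j)) (1s-pos (ℕP.m<n⇒0<n∸m j<i)))
    where
    1s-pos : ∀ {d} → 0 < d → 1s d ≡ 0ℤ
    1s-pos {suc d} _ = refl

  private
    2*n≡n+n : ∀ n → 2 ℕ.* n ≡ n ℕ.+ n
    2*n≡n+n n = cong (n ℕ.+_) (ℕP.+-identityʳ n)

    +-double-injective : ∀ {a b} → a ℕ.+ a ≡ b ℕ.+ b → a ≡ b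
    +-double-injective {a} {b} e = trans (ℕP.n≡⌊n+n/2⌋ a) (trans (cong ⌊_/2⌋ e) (sym (ℕP.n≡⌊n+n/2⌋ b)))

    even≢odd : ∀ a b → a ℕ.+ a ≢ suc (b ℕ.+ b)
    even≢odd a b e = ℕP.even≢odd a b (trans (2*n≡n+n a) (trans e (cong suc (sym (2*n≡n+n b)))))

  [1+X²]^-coeff : ∀ k i → ((1+X²) ^ k) i ≡ Σ< (λ l → + (k C l) * shiftBy (l ℕ.+ l) 1s i) (suc k)
  [1+X²]^-coeff k i =
    trans (binomial-theorem k X² 1s i)
    (trans (binomialExpansion-coeff X² 1s k i)
           (Σ<-cong (suc k) (λ l → cong (+ (k C l) *_) (trans (⊛-congˡ (1s^ (k ∸ l)) i) (X²^⊛ l 1s i)))))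

  [1+X²]^-even : ∀ k a → ((1+X²) ^ k) (a ℕ.+ a) ≡ + (k C a)
  [1+X²]^-even k a with a ℕP.<? suc k
  ... | yes a≤k =
    trans ([1+X²]^-coeff k (a ℕ.+ a))
    (trans (Σ<-single _ (suc k) a a≤k
             (λ l _ l≢a → trans (cong (+ (k C l) *_) (shiftBy-1s-≢ _ _ (l≢a ∘ +-double-injective)))
                               (ℤP.*-zeroʳ (+ (k C l)))))
           (trans (cong (+ (k C a) *_) (shiftBy-1s-≡ (a ℕ.+ a))) (ℤP.*-identityʳ _)))
  ... | no a≰k =
    trans ([1+X²]^-coeff k (a ℕ.+ a))
    (trans (Σ<-zero _ (suc k)
             (λ l l≤k → trans (cong (+ (k C l) *_)
                                    (shiftBy-1s-≢ _ _ (λ e → a≰k (subst (_< suc k) (+-double-injective e) l≤k))))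
                              (ℤP.*-zeroʳ (+ (k C l)))))
           (sym (cong +_ (k>n⇒nCk≡0 (ℕP.≰⇒> (a≰k ∘ s≤s))))))

  [1+X²]^-odd : ∀ k a → ((1+X²) ^ k) (suc (a ℕ.+ a)) ≡ 0ℤ
  [1+X²]^-odd k a =
    trans ([1+X²]^-coeff k _)
          (Σ<-zero _ (suc k) (λ l _ → trans (cong (+ (k C l) *_) (shiftBy-1s-≢ _ _ (λ e → even≢odd l a e)))
                                            (ℤP.*-zeroʳ (+ (k C l)))))

  P : Series
  P = 1+X² ⊕ X

  P^-coeff : ∀ n t →
    (P ^ n) (n ℕ.+ (t ℕ.+ t)) ≡ Σ< (λ j → + (n C (j ℕ.+ j)) * + ((j ℕ.+ j) C (j ℕ.+ t))) (suc n)
  P^-coeff n t = begin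
      (P ^ n) i
    ≡⟨ binomial-theorem n 1+X² X i ⟩
      binomialExpansion 1+X² X n i
    ≡⟨ binomialExpansion-coeff 1+X² X n i ⟩
      Σ< (λ k → + (n C k) * ((1+X²) ^ k ⊛ X ^ (n ∸ k)) i) (suc n)
    ≡⟨ Σ<-cong< (suc n) X-factor ⟩
      Σ< g (suc n)
    ≡⟨ sym (Σ<-extend g (suc n) (suc n) g-vanishes) ⟩
      Σ< g (suc n ℕ.+ suc n)
    ≡⟨ Σ<-evens-odds g (suc n) ⟩
      Σ< (λ j → g (j ℕ.+ j)) (suc n) + Σ< (λ j → g (suc (j ℕ.+ j))) (suc n)
    ≡⟨ cong₂ _+_ (Σ<-cong (suc n) g-even) (Σ<-zero _ (suc n) (λ j _ → g-odd j)) ⟩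
      Σ< (λ j → + (n C (j ℕ.+ j)) * + ((j ℕ.+ j) C (j ℕ.+ t))) (suc n) + 0ℤ
    ≡⟨ ℤP.+-identityʳ _ ⟩
      Σ< (λ j → + (n C (j ℕ.+ j)) * + ((j ℕ.+ j) C (j ℕ.+ t))) (suc n)
    ∎
    where
    open ≡-Reasoning
    i = n ℕ.+ (t ℕ.+ t)
    g : ℕ → ℤ
    g k = + (n C k) * ((1+X²) ^ k) (k ℕ.+ (t ℕ.+ t))
    X-factor : ∀ k → k < suc n → + (n C k) * ((1+X²) ^ k ⊛ X ^ (n ∸ k)) i ≡ g k
    X-factor k (s≤s k≤n) = cong (+ (n C k) *_)
      (trans (⊛-comm ((1+X²) ^ k) (X ^ (n ∸ k)) i)
      (trans (X^⊛ (n ∸ k) ((1+X²) ^ k) i)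
      (trans (cong (shiftBy (n ∸ k) ((1+X²) ^ k)) i≡[n∸k]+[k+2t])
             (shiftBy-+ (n ∸ k) ((1+X²) ^ k) _))))
      where
      i≡[n∸k]+[k+2t] : i ≡ (n ∸ k) ℕ.+ (k ℕ.+ (t ℕ.+ t))
      i≡[n∸k]+[k+2t] = trans (cong (ℕ._+ (t ℕ.+ t)) (sym (ℕP.m∸n+n≡m k≤n))) (ℕP.+-assoc (n ∸ k) k (t ℕ.+ t))
    g-vanishes : ∀ k → suc n ≤ k → g k ≡ 0ℤ
    g-vanishes k n<k =
      trans (cong (λ c → + c * ((1+X²) ^ k) (k ℕ.+ (t ℕ.+ t))) (k>n⇒nCk≡0 n<k))
            (ℤP.*-zeroˡ (((1+X²) ^ k) (k ℕ.+ (t ℕ.+ t))))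
    2j+2t≡2[j+t] : ∀ j → (j ℕ.+ j) ℕ.+ (t ℕ.+ t) ≡ (j ℕ.+ t) ℕ.+ (j ℕ.+ t)
    2j+2t≡2[j+t] j = regroup j t
      where
      regroup : ∀ j t → (j ℕ.+ j) ℕ.+ (t ℕ.+ t) ≡ (j ℕ.+ t) ℕ.+ (j ℕ.+ t)
      regroup = ℕ-Solver.solve-∀
    g-even : ∀ j → g (j ℕ.+ j) ≡ + (n C (j ℕ.+ j)) * + ((j ℕ.+ j) C (j ℕ.+ t))
    g-even j = cong (+ (n C (j ℕ.+ j)) *_)
      (trans (cong ((1+X²) ^ (j ℕ.+ j)) (2j+2t≡2[j+t] j)) ([1+X²]^-even (j ℕ.+ j) (j ℕ.+ t)))
    g-odd : ∀ j → g (suc (j ℕ.+ j)) ≡ 0ℤ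
    g-odd j = trans (cong (+ (n C suc (j ℕ.+ j)) *_)
                          (trans (cong ((1+X²) ^ suc (j ℕ.+ j)) (cong suc (2j+2t≡2[j+t] j)))
                                 ([1+X²]^-odd (suc (j ℕ.+ j)) (j ℕ.+ t))))
                    (ℤP.*-zeroʳ (+ (n C suc (j ℕ.+ j))))

  sumTo-Σ< : ∀ f n → + sumTo f n ≡ Σ< (+_ ∘ f) (suc n)
  sumTo-Σ< f zero    = sym (ℤP.+-identityʳ _)
  sumTo-Σ< f (suc n) =
    trans (ℤP.pos-+ (sumTo f n) (f (suc n)))
          (trans (cong (_+ + f (suc n)) (sumTo-Σ< f n)) (sym (Σ<-suc (+_ ∘ f) (suc n))))

  catalan-ℤ : ∀ k → + catalan k ≡ + ((2 ℕ.* k) C k) - + ((2 ℕ.* k) C suc k)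
  catalan-ℤ k = begin
      + catalan k                 ≡⟨ cancel (+ catalan k) b ⟩
      (+ catalan k + b) - b       ≡⟨ cong (_- b) (trans (sym (ℤP.pos-+ (catalan k) _)) (cong +_ (catalan+2kC[1+k]≡2kCk k))) ⟩
      + ((2 ℕ.* k) C k) - b       ∎
    where
    open ≡-Reasoning
    b = + ((2 ℕ.* k) C suc k)
    cancel : ∀ c b → c ≡ (c + b) - b
    cancel = solve-∀

  motzkin≡P^n[n]-P^n[n+2] : ∀ n → + motzkin n ≡ (P ^ n) n - (P ^ n) (n ℕ.+ 2)
  motzkin≡P^n[n]-P^n[n+2] n = begin
      + motzkin n
    ≡⟨ sumTo-Σ< _ n ⟩
      Σ< (λ k → + ((n C (2 ℕ.* k)) ℕ.* catalan k)) (suc n)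
    ≡⟨ Σ<-cong (suc n) catalan-split ⟩
      Σ< (λ j → term j 0 - term j 1) (suc n)
    ≡⟨ Σ<-- (λ j → term j 0) (λ j → term j 1) (suc n) ⟩
      Σ< (λ j → term j 0) (suc n) - Σ< (λ j → term j 1) (suc n)
    ≡⟨ sym (cong₂ _-_ (trans (cong (P ^ n) (sym (ℕP.+-identityʳ n))) (P^-coeff n 0)) (P^-coeff n 1)) ⟩
      (P ^ n) n - (P ^ n) (n ℕ.+ 2)
    ∎
    where
    open ≡-Reasoning
    term : ℕ → ℕ → ℤ
    term j t = + (n C (j ℕ.+ j)) * + ((j ℕ.+ j) C (j ℕ.+ t))
    catalan-split : ∀ k → + ((n C (2 ℕ.* k)) ℕ.* catalan k) ≡ term k 0 - term k 1
    catalan-split k = begin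
        + ((n C (2 ℕ.* k)) ℕ.* catalan k)
      ≡⟨ trans (ℤP.pos-* (n C (2 ℕ.* k)) (catalan k)) (cong (+ (n C (2 ℕ.* k)) *_) (catalan-ℤ k)) ⟩
        + (n C (2 ℕ.* k)) * (+ ((2 ℕ.* k) C k) - + ((2 ℕ.* k) C suc k))
      ≡⟨ cong₂ (λ a c → + (n C a) * (+ (a C c) - + (a C suc k))) (2*n≡n+n k) (sym (ℕP.+-identityʳ k)) ⟩
        + (n C (k ℕ.+ k)) * (+ ((k ℕ.+ k) C (k ℕ.+ 0)) - + ((k ℕ.+ k) C suc k))
      ≡⟨ cong (λ c → + (n C (k ℕ.+ k)) * (+ ((k ℕ.+ k) C (k ℕ.+ 0)) - + ((k ℕ.+ k) C c))) (ℕP.+-comm 1 k) ⟩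
        + (n C (k ℕ.+ k)) * (+ ((k ℕ.+ k) C (k ℕ.+ 0)) - + ((k ℕ.+ k) C (k ℕ.+ 1)))
      ≡⟨ distrib (+ (n C (k ℕ.+ k))) (+ ((k ℕ.+ k) C (k ℕ.+ 0))) (+ ((k ℕ.+ k) C (k ℕ.+ 1))) ⟩
        term k 0 - term k 1
      ∎
      where
      distrib : ∀ a b c → a * (b - c) ≡ a * b - a * c
      distrib = solve-∀


module Dilation where

  open import Data.Nat as ℕ using (ℕ; zero; suc)
  import Data.Nat.Properties as ℕP
  open import Data.Integer using (ℤ; 0ℤ; _+_; _*_)
  import Data.Integer.Properties as ℤP
  open import Function using (_∘_)
  open import Relation.Binary.PropositionalEquality

  open PowerSeries
  open BinaryDigits using (even; odd; evenOdd)

  dilate : Series → Series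
  dilate f zero          = f 0
  dilate f (suc zero)    = 0ℤ
  dilate f (suc (suc i)) = dilate (tail f) i

  evens : Series → Series
  evens f j = f (j ℕ.+ j)

  dilate-even : ∀ f N → dilate f (N ℕ.+ N) ≡ f N
  dilate-even f zero    = refl
  dilate-even f (suc N) = trans (cong (dilate f ∘ suc) (ℕP.+-suc N N)) (dilate-even (tail f) N)

  dilate-odd : ∀ f N → dilate f (suc (N ℕ.+ N)) ≡ 0ℤ
  dilate-odd f zero    = refl
  dilate-odd f (suc N) = trans (cong (dilate f ∘ suc ∘ suc) (ℕP.+-suc N N)) (dilate-odd (tail f) N)

  evens-dilate : ∀ f → evens (dilate f) ≈ f
  evens-dilate = dilate-even

  dilate-cong : ∀ {f g} → f ≈ g → dilate f ≈ dilate g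
  dilate-cong e zero          = e 0
  dilate-cong e (suc zero)    = refl
  dilate-cong e (suc (suc i)) = dilate-cong (e ∘ suc) i

  dilate-1s : dilate 1s ≈ 1s
  dilate-1s i with evenOdd i
  ... | even zero    = refl
  ... | even (suc N) = dilate-even 1s (suc N)
  ... | odd N        = dilate-odd 1s N

  dilate-0s : dilate 0s ≈ 0s
  dilate-0s i with evenOdd i
  ... | even N = dilate-even 0s N
  ... | odd N  = dilate-odd 0s N

  tail-dilate : ∀ f → tail (dilate f) ≈ shift (dilate (tail f))
  tail-dilate f zero    = refl
  tail-dilate f (suc j) = refl

  evens-shift : ∀ f → evens (shift f) ≈ shift (evens (tail f))
  evens-shift f zero    = refl
  evens-shift f (suc j) = cong (shift f ∘ suc) (ℕP.+-suc j j)

  tail-dilate-⊛ : ∀ g f → tail (dilate g) ⊛ f ≈ dilate (tail g) ⊛ shift f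
  tail-dilate-⊛ g f = ≈-trans (⊛-congʳ (tail-dilate g)) (shift-⊛ (dilate (tail g)) f)

  mutual
    dilate-⊛-even : ∀ N g f → (dilate g ⊛ f) (N ℕ.+ N) ≡ (g ⊛ evens f) N
    dilate-⊛-even zero    g f = refl
    dilate-⊛-even (suc N) g f = begin
        (dilate g ⊛ f) (suc N ℕ.+ suc N)
      ≡⟨ cong ((dilate g ⊛ f) ∘ suc) (ℕP.+-suc N N) ⟩
        g 0 * f (suc (suc (N ℕ.+ N))) + (tail (dilate g) ⊛ f) (suc (N ℕ.+ N))
      ≡⟨ cong (_+_ (g 0 * f (suc (suc (N ℕ.+ N))))) (tail-dilate-⊛ g f (suc (N ℕ.+ N))) ⟩
        g 0 * f (suc (suc (N ℕ.+ N))) + (dilate (tail g) ⊛ shift f) (suc (N ℕ.+ N))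
      ≡⟨ cong₂ (λ a b → g 0 * f a + b) (cong suc (sym (ℕP.+-suc N N))) (dilate-⊛-odd N (tail g) (shift f)) ⟩
        g 0 * f (suc N ℕ.+ suc N) + (tail g ⊛ evens f) N
      ∎
      where open ≡-Reasoning

    dilate-⊛-odd : ∀ N g f → (dilate g ⊛ f) (suc (N ℕ.+ N)) ≡ (g ⊛ evens (tail f)) N
    dilate-⊛-odd zero    g f = trans (cong (_+_ (g 0 * f 1)) (ℤP.*-zeroˡ (f 0))) (ℤP.+-identityʳ _)
    dilate-⊛-odd (suc N) g f = begin
        g 0 * f (suc i) + (tail (dilate g) ⊛ f) i
      ≡⟨ cong (_+_ (g 0 * f (suc i))) (tail-dilate-⊛ g f i) ⟩
        g 0 * f (suc i) + (dilate (tail g) ⊛ shift f) i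
      ≡⟨ cong (_+_ (g 0 * f (suc i))) (dilate-⊛-even (suc N) (tail g) (shift f)) ⟩
        g 0 * f (suc i) + (tail g ⊛ evens (shift f)) (suc N)
      ≡⟨ cong (_+_ (g 0 * f (suc i)))
              (trans (⊛-congˡ {tail g} (evens-shift f) (suc N)) (sym (shift-⊛ (tail g) (evens (tail f)) (suc N)))) ⟩
        g 0 * f (suc i) + (shift (tail g) ⊛ evens (tail f)) (suc N)
      ≡⟨ sym (⊛-head g (evens (tail f)) (suc N)) ⟩
        (g ⊛ evens (tail f)) (suc N)
      ∎
      where
      open ≡-Reasoning
      i = suc N ℕ.+ suc N

  dilate-⊛ : ∀ f g → dilate (f ⊛ g) ≈ dilate f ⊛ dilate g
  dilate-⊛ f g i with evenOdd i
  ... | even N = trans (dilate-even (f ⊛ g) N)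
                       (sym (trans (dilate-⊛-even N f (dilate g)) (⊛-congˡ (evens-dilate g) N)))
  ... | odd N  = trans (dilate-odd (f ⊛ g) N)
                       (sym (trans (dilate-⊛-odd N f (dilate g))
                                   (trans (⊛-congˡ (dilate-odd g) N) (trans (⊛-comm f 0s N) (⊛-zeroˡ f N)))))


module CongruenceMod where

  open import Data.Integer using (ℤ; +_; _+_; _*_)
  import Data.Integer.Properties as ℤP
  open import Data.Integer.Tactic.RingSolver using (solve-∀)
  open import Relation.Binary.PropositionalEquality

  open PowerSeries

  infix 4 _≡_[modℤ_] _≋_[mod_]

  record _≡_[modℤ_] (a b c : ℤ) : Set where
    constructor _,_
    field
      quotient : ℤ
      equation : a ≡ b + c * quotient

  record _≋_[mod_] (F G : Series) (c : ℤ) : Set where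
    constructor _,_
    field
      quotient : Series
      equation : F ≈ G ⊕ scale c quotient

  ≡-modℤ-trans : ∀ {a b d c} → a ≡ b [modℤ c ] → b ≡ d [modℤ c ] → a ≡ d [modℤ c ]
  ≡-modℤ-trans {d = d} {c} (q , e) (q′ , e′) =
    (q′ + q) , trans e (trans (cong (_+ c * q) e′) (regroup d c q′ q))
    where
    regroup : ∀ d c q′ q → d + c * q′ + c * q ≡ d + c * (q′ + q)
    regroup = solve-∀

  ≋-reflexive : ∀ {F G c} → F ≈ G → F ≋ G [mod c ]
  ≋-reflexive {G = G} {c} e = 0s , λ n → trans (e n) (sym (trans (cong (_+_ (G n)) (ℤP.*-zeroʳ c)) (ℤP.+-identityʳ (G n))))

  ≋-respˡ : ∀ {F F′ G c} → F ≈ F′ → F′ ≋ G [mod c ] → F ≋ G [mod c ]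
  ≋-respˡ e (Q , e′) = Q , ≈-trans e e′

  ≋-respʳ : ∀ {F G G′ c} → G ≈ G′ → F ≋ G′ [mod c ] → F ≋ G [mod c ]
  ≋-respʳ {c = c} e (Q , e′) = Q , λ n → trans (e′ n) (cong (_+ c * Q n) (sym (e n)))

  ≋-coeff : ∀ {F G c} → F ≋ G [mod c ] → ∀ n → F n ≡ G n [modℤ c ]
  ≋-coeff (Q , e) n = Q n , e n

  ≋-⊛ˡ : ∀ {F G c} H → F ≋ G [mod c ] → H ⊛ F ≋ H ⊛ G [mod c ]
  ≋-⊛ˡ {G = G} {c} H (Q , e) =
    (H ⊛ Q) , ≈-trans (⊛-congˡ {H} e)
                      (≈-trans (⊛-distribˡ H G (scale c Q)) (⊕-cong {H ⊛ G} ≈-refl (⊛-scaleʳ c H Q)))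

  ≋-⊛ʳ : ∀ {F G c} H → F ≋ G [mod c ] → F ⊛ H ≋ G ⊛ H [mod c ]
  ≋-⊛ʳ {F} {G} H e = ≋-respˡ (⊛-comm F H) (≋-respʳ (⊛-comm G H) (≋-⊛ˡ H e))

  ⊛-expand : ∀ k g g′ D D′ →
    (g ⊕ scale k D) ⊛ (g′ ⊕ scale k D′) ≈ g ⊛ g′ ⊕ scale k ((D ⊛ g′ ⊕ g ⊛ D′) ⊕ scale k (D ⊛ D′))
  ⊛-expand k g g′ D D′ n = begin
      ((g ⊕ scale k D) ⊛ (g′ ⊕ scale k D′)) n
    ≡⟨ ⊛-distribʳ (g′ ⊕ scale k D′) g (scale k D) n ⟩
      (g ⊛ (g′ ⊕ scale k D′)) n + (scale k D ⊛ (g′ ⊕ scale k D′)) n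
    ≡⟨ cong₂ _+_ (⊛-distribˡ g g′ (scale k D′) n) (⊛-distribˡ (scale k D) g′ (scale k D′) n) ⟩
      ((g ⊛ g′) n + (g ⊛ scale k D′) n) + ((scale k D ⊛ g′) n + (scale k D ⊛ scale k D′) n)
    ≡⟨ cong₂ (λ a b → ((g ⊛ g′) n + a) + b) (⊛-scaleʳ k g D′ n)
             (cong₂ _+_ (⊛-scaleˡ k D g′ n) (trans (⊛-scaleˡ k D (scale k D′) n) (cong (k *_) (⊛-scaleʳ k D D′ n)))) ⟩
      ((g ⊛ g′) n + k * (g ⊛ D′) n) + (k * (D ⊛ g′) n + k * (k * (D ⊛ D′) n))
    ≡⟨ regroup ((g ⊛ g′) n) k ((g ⊛ D′) n) ((D ⊛ g′) n) ((D ⊛ D′) n) ⟩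
      (g ⊛ g′) n + k * (((D ⊛ g′) n + (g ⊛ D′) n) + k * (D ⊛ D′) n)
    ∎
    where
    open ≡-Reasoning
    regroup : ∀ a k b c d → (a + k * b) + (k * c + k * (k * d)) ≡ a + k * ((c + b) + k * d)
    regroup = solve-∀

  ≋-⊛ : ∀ {F F′ G G′ c} → F ≋ G [mod c ] → F′ ≋ G′ [mod c ] → F ⊛ F′ ≋ G ⊛ G′ [mod c ]
  ≋-⊛ {G = G} {G′} {c} (Q , e) (Q′ , e′) = _ , ≈-trans (⊛-cong e e′) (⊛-expand c G G′ Q Q′)

  ≋-square : ∀ {F G} h → F ≋ G [mod h + h ] → F ⊛ F ≋ G ⊛ G [mod h + h + h + h ]
  ≋-square {G = G} h (D , e) =
    (G ⊛ D ⊕ scale h (D ⊛ D)) ,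
    λ n → trans (⊛-cong e e n)
          (trans (⊛-expand (h + h) G G D D n)
          (trans (cong (λ z → (G ⊛ G) n + (h + h) * ((z + (G ⊛ D) n) + (h + h) * (D ⊛ D) n)) (⊛-comm D G n))
                 (regroup ((G ⊛ G) n) h ((G ⊛ D) n) ((D ⊛ D) n))))
    where
    regroup : ∀ a h b d → a + (h + h) * ((b + b) + (h + h) * d) ≡ a + (h + h + h + h) * (b + h * d)
    regroup = solve-∀


module Frobenius where

  open import Data.Nat as ℕ using (ℕ; zero; suc)
  import Data.Nat.Properties as ℕP
  open import Data.Integer using (ℤ; +_; 0ℤ; 1ℤ; _+_; _*_)
  open import Relation.Binary.PropositionalEquality

  open PowerSeries
  open Trinomial using (P; X²)
  open Dilation
  open CongruenceMod

  P⊛ : ∀ g → P ⊛ g ≈ shift (shift g) ⊕ g ⊕ shift g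
  P⊛ g = ≈-trans (⊛-distribʳ g (X² ⊕ 1s) X)
         (⊕-cong (≈-trans (⊛-distribʳ g X² 1s)
                          (⊕-cong (≈-trans (⊛-assoc X X g) (≈-trans (X⊛ (X ⊛ g)) (shift-cong (X⊛ g))))
                                  (⊛-identityˡ g)))
                 (X⊛ g))

  1+X+X² : Series
  1+X+X² 0 = 1ℤ
  1+X+X² 1 = 1ℤ
  1+X+X² 2 = 1ℤ
  1+X+X² _ = 0ℤ

  P≈1+X+X² : P ≈ 1+X+X²
  P≈1+X+X² = ≈-trans (≈-sym (≈-trans (⊛-comm P 1s) (⊛-identityˡ P))) (≈-trans (P⊛ 1s) coefficients)
    where
    coefficients : shift (shift 1s) ⊕ 1s ⊕ shift 1s ≈ 1+X+X²
    coefficients 0 = refl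
    coefficients 1 = refl
    coefficients 2 = refl
    coefficients (suc (suc (suc n))) = refl

  P⊛P≈dilate-P+2XP : P ⊛ P ≈ dilate P ⊕ scale (+ 2) (X ⊛ P)
  P⊛P≈dilate-P+2XP = begin
      P ⊛ P                                        ≈⟨ P⊛ P ⟩
      shift (shift P) ⊕ P ⊕ shift P                ≈⟨ ⊕-cong (⊕-cong (shift-cong (shift-cong P≈p)) P≈p) (shift-cong P≈p) ⟩
      shift (shift p) ⊕ p ⊕ shift p                ≈⟨ coefficients ⟩
      dilate p ⊕ scale (+ 2) (shift p)             ≈⟨ ⊕-cong (dilate-cong (≈-sym P≈p)) (λ n → cong (+ 2 *_) (shift-cong (≈-sym P≈p) n)) ⟩
      dilate P ⊕ scale (+ 2) (shift P)             ≈⟨ ⊕-cong {dilate P} ≈-refl (λ n → cong (+ 2 *_) (X⊛ P n)) ⟨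
      dilate P ⊕ scale (+ 2) (X ⊛ P)               ∎
    where
    open ≈-Reasoning
    p = 1+X+X²
    P≈p = P≈1+X+X²
    coefficients : shift (shift p) ⊕ p ⊕ shift p ≈ dilate p ⊕ scale (+ 2) (shift p)
    coefficients 0 = refl
    coefficients 1 = refl
    coefficients 2 = refl
    coefficients 3 = refl
    coefficients 4 = refl
    coefficients 5 = refl
    coefficients (suc (suc (suc (suc (suc (suc i)))))) =
      sym (cong (_+ + 2 * 0ℤ) (trans (dilate-cong {g = 0s} (λ _ → refl) i) (dilate-0s i)))

  P^2≋dilate-P : P ^ 2 ≋ dilate P [mod + 2 ]
  P^2≋dilate-P = (X ⊛ P) , ≈-trans (^2≈⊛ P) P⊛P≈dilate-P+2XP

  P^4≋dilate-P^2 : P ^ 4 ≋ dilate (P ^ 2) [mod + 4 ]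
  P^4≋dilate-P^2 =
    ≋-respˡ {G = dilate (P ^ 2)} (^-homo-* P 2 2)
            (≋-respʳ (≈-trans (dilate-cong (^2≈⊛ P)) (dilate-⊛ P P)) (≋-square (+ 1) P^2≋dilate-P))

  P^8≋dilate-P^4 : P ^ 8 ≋ dilate (P ^ 4) [mod + 8 ]
  P^8≋dilate-P^4 =
    ≋-respˡ {G = dilate (P ^ 4)} (^-homo-* P 4 4)
            (≋-respʳ (≈-trans (dilate-cong (^-homo-* P 2 2)) (dilate-⊛ (P ^ 2) (P ^ 2)))
                     (≋-square (+ 2) P^4≋dilate-P^2))

  P^[8m]≋dilate-P^[4m] : ∀ m → P ^ (8 ℕ.* m) ≋ dilate (P ^ (4 ℕ.* m)) [mod + 8 ]
  P^[8m]≋dilate-P^[4m] zero    = ≋-reflexive (≈-sym dilate-1s)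
  P^[8m]≋dilate-P^[4m] (suc m) =
    ≋-respˡ {G = dilate (P ^ (4 ℕ.* suc m))} (≈-trans (^-≡ P (ℕP.*-suc 8 m)) (^-homo-* P 8 (8 ℕ.* m)))
            (≋-respʳ (≈-trans (dilate-cong (≈-trans (^-≡ P (ℕP.*-suc 4 m)) (^-homo-* P 4 (4 ℕ.* m))))
                              (dilate-⊛ (P ^ 4) (P ^ (4 ℕ.* m))))
                     (≋-⊛ P^8≋dilate-P^4 (P^[8m]≋dilate-P^[4m] m)))


module CoefficientSequence where

  open import Data.Bool using (Bool; true; false)
  open import Data.Nat as ℕ using (ℕ; _∸_)
  open import Data.Nat.Tactic.RingSolver using (solve-∀)
  open import Data.Integer using (ℤ; +_)
  open import Relation.Binary.PropositionalEquality

  open PowerSeries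
  open Trinomial using (P)
  open Dilation
  open CongruenceMod
  open Frobenius using (P^[8m]≋dilate-P^[4m])
  open BinaryDigits using (bit)

  -- The offset 6 keeps all the shifts in nextSeries and in the initial series non-negative.
  coeffSeq : Series → ℕ → ℤ
  coeffSeq W m = (P ^ (4 ℕ.* m) ⊛ W) (4 ℕ.* m ℕ.+ 6)

  coeffSeq-≋ : ∀ {W W′} → W ≋ W′ [mod + 8 ] → ∀ m → coeffSeq W m ≡ coeffSeq W′ m [modℤ + 8 ]
  coeffSeq-≋ e m = ≋-coeff (≋-⊛ˡ (P ^ (4 ℕ.* m)) e) (4 ℕ.* m ℕ.+ 6)

  digitShift : Bool → ℕ
  digitShift b = 3 ∸ 2 ℕ.* bit b

  nextSeries : Bool → Series → Series
  nextSeries b W = shiftBy (digitShift b) (evens (P ^ (4 ℕ.* bit b) ⊛ W))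

  coeffSeq-2m+b : ∀ W m b → coeffSeq W (2 ℕ.* m ℕ.+ bit b) ≡ coeffSeq (nextSeries b W) m [modℤ + 8 ]
  coeffSeq-2m+b W m b = subst₂ (λ x y → x ≡ y [modℤ + 8 ]) (sym lhs) rhs
                               (≋-coeff (≋-⊛ʳ V (P^[8m]≋dilate-P^[4m] m)) (N ℕ.+ N))
    where
    r = bit b
    G = P ^ (4 ℕ.* m)
    V = P ^ (4 ℕ.* r) ⊛ W
    N = 4 ℕ.* m ℕ.+ (2 ℕ.* r ℕ.+ 3)
    lhs : coeffSeq W (2 ℕ.* m ℕ.+ r) ≡ (P ^ (8 ℕ.* m) ⊛ V) (N ℕ.+ N)
    lhs = begin
        (P ^ (4 ℕ.* (2 ℕ.* m ℕ.+ r)) ⊛ W) (4 ℕ.* (2 ℕ.* m ℕ.+ r) ℕ.+ 6)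
      ≡⟨ cong₂ (λ a i → (P ^ a ⊛ W) i) (exponent m r) (index m r) ⟩
        (P ^ (8 ℕ.* m ℕ.+ 4 ℕ.* r) ⊛ W) (N ℕ.+ N)
      ≡⟨ ⊛-congʳ (^-homo-* P (8 ℕ.* m) (4 ℕ.* r)) (N ℕ.+ N) ⟩
        ((P ^ (8 ℕ.* m) ⊛ P ^ (4 ℕ.* r)) ⊛ W) (N ℕ.+ N)
      ≡⟨ ⊛-assoc (P ^ (8 ℕ.* m)) (P ^ (4 ℕ.* r)) W (N ℕ.+ N) ⟩
        (P ^ (8 ℕ.* m) ⊛ V) (N ℕ.+ N)
      ∎
      where
      open ≡-Reasoning
      exponent : ∀ m r → 4 ℕ.* (2 ℕ.* m ℕ.+ r) ≡ 8 ℕ.* m ℕ.+ 4 ℕ.* r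
      exponent = solve-∀
      index : ∀ m r → 4 ℕ.* (2 ℕ.* m ℕ.+ r) ℕ.+ 6 ≡
                      (4 ℕ.* m ℕ.+ (2 ℕ.* r ℕ.+ 3)) ℕ.+ (4 ℕ.* m ℕ.+ (2 ℕ.* r ℕ.+ 3))
      index = solve-∀
    rhs : (dilate G ⊛ V) (N ℕ.+ N) ≡ coeffSeq (nextSeries b W) m
    rhs = begin
        (dilate G ⊛ V) (N ℕ.+ N)
      ≡⟨ dilate-⊛-even N G V ⟩
        (G ⊛ evens V) N
      ≡⟨ ⊛-shiftBy-+ (digitShift b) G (evens V) N ⟨
        (G ⊛ nextSeries b W) (digitShift b ℕ.+ N)
      ≡⟨ cong (G ⊛ nextSeries b W) (sym (index b)) ⟩
        (G ⊛ nextSeries b W) (4 ℕ.* m ℕ.+ 6)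
      ∎
      where
      open ≡-Reasoning
      index : ∀ b → 4 ℕ.* m ℕ.+ 6 ≡ digitShift b ℕ.+ (4 ℕ.* m ℕ.+ (2 ℕ.* bit b ℕ.+ 3))
      index false = index₀ m
        where
        index₀ : ∀ m → 4 ℕ.* m ℕ.+ 6 ≡ 3 ℕ.+ (4 ℕ.* m ℕ.+ 3)
        index₀ = solve-∀
      index true  = index₁ m
        where
        index₁ : ∀ m → 4 ℕ.* m ℕ.+ 6 ≡ 1 ℕ.+ (4 ℕ.* m ℕ.+ 5)
        index₁ = solve-∀


module Polynomial where

  open import Data.Bool using (Bool)
  open import Data.Nat as ℕ using (ℕ; zero; suc)
  import Data.Nat.Properties as ℕP
  open import Data.Integer using (ℤ; +_; 0ℤ; 1ℤ; _+_; _*_)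
  import Data.Integer.Properties as ℤP
  open import Data.Integer.DivMod using (_%ℕ_; _/ℕ_; a≡a%ℕn+[a/ℕn]*n)
  open import Data.List using (List; []; _∷_; map)
  open import Function using (_∘_)
  open import Relation.Binary.PropositionalEquality

  open PowerSeries
  open Trinomial using (P)
  open Dilation
  open CongruenceMod
  open Frobenius using (P≈1+X+X²)
  open CoefficientSequence
  open BinaryDigits using (bit)

  ⟦_⟧ : List ℤ → Series
  ⟦ [] ⟧    _       = 0ℤ
  ⟦ a ∷ l ⟧ zero    = a
  ⟦ a ∷ l ⟧ (suc n) = ⟦ l ⟧ n

  infixl 6 _+ᴾ_
  infixl 7 _*ᴾ_

  _+ᴾ_ : List ℤ → List ℤ → List ℤ
  []      +ᴾ l       = l
  (a ∷ k) +ᴾ []      = a ∷ k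
  (a ∷ k) +ᴾ (b ∷ l) = (a + b) ∷ (k +ᴾ l)

  scaleᴾ : ℤ → List ℤ → List ℤ
  scaleᴾ c = map (c *_)

  _*ᴾ_ : List ℤ → List ℤ → List ℤ
  []      *ᴾ l = []
  (a ∷ k) *ᴾ l = scaleᴾ a l +ᴾ (0ℤ ∷ k *ᴾ l)

  _^ᴾ_ : List ℤ → ℕ → List ℤ
  l ^ᴾ zero  = 1ℤ ∷ []
  l ^ᴾ suc k = l *ᴾ l ^ᴾ k

  evensᴾ : List ℤ → List ℤ
  evensᴾ []          = []
  evensᴾ (a ∷ [])    = a ∷ []
  evensᴾ (a ∷ b ∷ l) = a ∷ evensᴾ l

  shiftByᴾ : ℕ → List ℤ → List ℤ
  shiftByᴾ zero    l = l
  shiftByᴾ (suc k) l = 0ℤ ∷ shiftByᴾ k l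

  ⟦⟧-+ : ∀ k l → ⟦ k +ᴾ l ⟧ ≈ ⟦ k ⟧ ⊕ ⟦ l ⟧
  ⟦⟧-+ []      l       n       = sym (ℤP.+-identityˡ _)
  ⟦⟧-+ (a ∷ k) []      n       = sym (ℤP.+-identityʳ _)
  ⟦⟧-+ (a ∷ k) (b ∷ l) zero    = refl
  ⟦⟧-+ (a ∷ k) (b ∷ l) (suc n) = ⟦⟧-+ k l n

  ⟦⟧-scale : ∀ c l → ⟦ scaleᴾ c l ⟧ ≈ scale c ⟦ l ⟧
  ⟦⟧-scale c []      n       = sym (ℤP.*-zeroʳ c)
  ⟦⟧-scale c (a ∷ l) zero    = refl
  ⟦⟧-scale c (a ∷ l) (suc n) = ⟦⟧-scale c l n

  ⟦0∷⟧ : ∀ l → ⟦ 0ℤ ∷ l ⟧ ≈ shift ⟦ l ⟧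
  ⟦0∷⟧ l zero    = refl
  ⟦0∷⟧ l (suc n) = refl

  ⟦⟧-* : ∀ k l → ⟦ k *ᴾ l ⟧ ≈ ⟦ k ⟧ ⊛ ⟦ l ⟧
  ⟦⟧-* []      l n = sym (⊛-zeroˡ ⟦ l ⟧ n)
  ⟦⟧-* (a ∷ k) l n = begin
      ⟦ scaleᴾ a l +ᴾ (0ℤ ∷ k *ᴾ l) ⟧ n
    ≡⟨ ⟦⟧-+ (scaleᴾ a l) (0ℤ ∷ k *ᴾ l) n ⟩
      ⟦ scaleᴾ a l ⟧ n + ⟦ 0ℤ ∷ k *ᴾ l ⟧ n
    ≡⟨ cong₂ _+_ (⟦⟧-scale a l n) (trans (⟦0∷⟧ (k *ᴾ l) n) (shift-cong (⟦⟧-* k l) n)) ⟩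
      a * ⟦ l ⟧ n + shift (⟦ k ⟧ ⊛ ⟦ l ⟧) n
    ≡⟨ cong (_+_ (a * ⟦ l ⟧ n)) (sym (trans (⊛-congʳ (≈-sym (X⊛ ⟦ k ⟧)) n)
                                         (trans (⊛-assoc X ⟦ k ⟧ ⟦ l ⟧ n) (X⊛ _ n)))) ⟩
      a * ⟦ l ⟧ n + (shift ⟦ k ⟧ ⊛ ⟦ l ⟧) n
    ≡⟨ sym (⊛-head ⟦ a ∷ k ⟧ ⟦ l ⟧ n) ⟩
      (⟦ a ∷ k ⟧ ⊛ ⟦ l ⟧) n
    ∎
    where open ≡-Reasoning

  ⟦⟧-^ : ∀ l k → ⟦ l ^ᴾ k ⟧ ≈ ⟦ l ⟧ ^ k
  ⟦⟧-^ l zero    zero    = refl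
  ⟦⟧-^ l zero    (suc n) = refl
  ⟦⟧-^ l (suc k) = ≈-trans (⟦⟧-* l (l ^ᴾ k)) (⊛-congˡ {⟦ l ⟧} (⟦⟧-^ l k))

  ⟦⟧-evens : ∀ l → ⟦ evensᴾ l ⟧ ≈ evens ⟦ l ⟧
  ⟦⟧-evens []          n       = refl
  ⟦⟧-evens (a ∷ [])    zero    = refl
  ⟦⟧-evens (a ∷ [])    (suc n) = refl
  ⟦⟧-evens (a ∷ b ∷ l) zero    = refl
  ⟦⟧-evens (a ∷ b ∷ l) (suc n) = trans (⟦⟧-evens l n) (cong (⟦ a ∷ b ∷ l ⟧ ∘ suc) (sym (ℕP.+-suc n n)))

  ⟦⟧-shiftBy : ∀ k l → ⟦ shiftByᴾ k l ⟧ ≈ shiftBy k ⟦ l ⟧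
  ⟦⟧-shiftBy zero    l = ≈-refl
  ⟦⟧-shiftBy (suc k) l = ≈-trans (⟦0∷⟧ (shiftByᴾ k l)) (shift-cong (⟦⟧-shiftBy k l))

  Pᴾ : List ℤ
  Pᴾ = 1ℤ ∷ 1ℤ ∷ 1ℤ ∷ []

  ⟦Pᴾ⟧ : ⟦ Pᴾ ⟧ ≈ P
  ⟦Pᴾ⟧ n = trans (coefficients n) (sym (P≈1+X+X² n))
    where
    coefficients : ⟦ Pᴾ ⟧ ≈ Frobenius.1+X+X²
    coefficients 0 = refl
    coefficients 1 = refl
    coefficients 2 = refl
    coefficients (suc (suc (suc n))) = refl

  ⟦_⟧ₙ : List ℕ → Series
  ⟦ l ⟧ₙ = ⟦ map +_ l ⟧

  coeffℕ : List ℕ → ℕ → ℕ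
  coeffℕ []      _       = 0
  coeffℕ (a ∷ l) zero    = a
  coeffℕ (a ∷ l) (suc n) = coeffℕ l n

  ⟦⟧ₙ-coeff : ∀ l n → ⟦ l ⟧ₙ n ≡ + coeffℕ l n
  ⟦⟧ₙ-coeff []      n       = refl
  ⟦⟧ₙ-coeff (a ∷ l) zero    = refl
  ⟦⟧ₙ-coeff (a ∷ l) (suc n) = ⟦⟧ₙ-coeff l n

  mod8 : List ℤ → List ℕ
  mod8 = map (_%ℕ 8)

  ⟦⟧-mod8 : ∀ l → ⟦ l ⟧ ≋ ⟦ mod8 l ⟧ₙ [mod + 8 ]
  ⟦⟧-mod8 l = ⟦ map (_/ℕ 8) l ⟧ , division l
    where
    division : ∀ l → ⟦ l ⟧ ≈ ⟦ mod8 l ⟧ₙ ⊕ scale (+ 8) ⟦ map (_/ℕ 8) l ⟧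
    division []      n       = sym (ℤP.*-zeroʳ (+ 8))
    division (a ∷ l) zero    = trans (a≡a%ℕn+[a/ℕn]*n a 8) (cong (_+_ (+ (a %ℕ 8))) (ℤP.*-comm (a /ℕ 8) (+ 8)))
    division (a ∷ l) (suc n) = division l n

  nextPolyℤ : Bool → List ℕ → List ℤ
  nextPolyℤ b R = shiftByᴾ (digitShift b) (evensᴾ (Pᴾ ^ᴾ (4 ℕ.* bit b) *ᴾ map +_ R))

  nextPoly : Bool → List ℕ → List ℕ
  nextPoly b R = mod8 (nextPolyℤ b R)

  nextSeries≈ : ∀ b R → nextSeries b ⟦ R ⟧ₙ ≈ ⟦ nextPolyℤ b R ⟧
  nextSeries≈ b R = ≈-sym (≈-trans (⟦⟧-shiftBy (digitShift b) _) (shiftBy-cong (digitShift b) evens-product))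
    where
    k = 4 ℕ.* bit b
    evens-product : ⟦ evensᴾ (Pᴾ ^ᴾ k *ᴾ map +_ R) ⟧ ≈ evens (P ^ k ⊛ ⟦ R ⟧ₙ)
    evens-product j = trans (⟦⟧-evens (Pᴾ ^ᴾ k *ᴾ map +_ R) j)
                      (trans (⟦⟧-* (Pᴾ ^ᴾ k) (map +_ R) (j ℕ.+ j))
                             (⊛-congʳ (≈-trans (⟦⟧-^ Pᴾ k) (^-congˡ k ⟦Pᴾ⟧)) (j ℕ.+ j)))

  coeffSeq-nextPoly : ∀ R m b → coeffSeq ⟦ R ⟧ₙ (2 ℕ.* m ℕ.+ bit b) ≡ coeffSeq ⟦ nextPoly b R ⟧ₙ m [modℤ + 8 ]
  coeffSeq-nextPoly R m b =
    ≡-modℤ-trans (coeffSeq-2m+b ⟦ R ⟧ₙ m b)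
                 (coeffSeq-≋ (≋-respˡ (nextSeries≈ b R) (⟦⟧-mod8 (nextPolyℤ b R))) m)


module BoolTable where

  open import Data.Bool using (Bool; true; false)
  open import Data.Nat using (ℕ; zero; suc)
  open import Data.Product using (_×_; _,_)
  import Data.Product.Properties as ×P
  open import Data.Vec using (Vec; []; _∷_)
  open import Function using (_∘_)
  open import Relation.Nullary using (Dec)
  open import Relation.Binary.Definitions using (DecidableEquality)
  open import Relation.Binary.PropositionalEquality

  Table : ℕ → Set → Set
  Table zero    A = A
  Table (suc n) A = Table n A × Table n A

  lookupᵀ : ∀ {n A} → Table n A → Vec Bool n → A
  lookupᵀ {zero}  a       []           = a
  lookupᵀ {suc n} (t , _) (false ∷ bs) = lookupᵀ t bs
  lookupᵀ {suc n} (_ , t) (true ∷ bs)  = lookupᵀ t bs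

  tabulateᵀ : ∀ {n A} → (Vec Bool n → A) → Table n A
  tabulateᵀ {zero}  f = f []
  tabulateᵀ {suc n} f = tabulateᵀ (f ∘ (false ∷_)) , tabulateᵀ (f ∘ (true ∷_))

  lookup∘tabulateᵀ : ∀ {n A} (f : Vec Bool n → A) bs → lookupᵀ (tabulateᵀ f) bs ≡ f bs
  lookup∘tabulateᵀ f []           = refl
  lookup∘tabulateᵀ f (false ∷ bs) = lookup∘tabulateᵀ (f ∘ (false ∷_)) bs
  lookup∘tabulateᵀ f (true ∷ bs)  = lookup∘tabulateᵀ (f ∘ (true ∷_)) bs

  tabulateᵀ-≡ : ∀ {n A} (f g : Vec Bool n → A) → tabulateᵀ f ≡ tabulateᵀ g → ∀ bs → f bs ≡ g bs
  tabulateᵀ-≡ f g e bs =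
    trans (sym (lookup∘tabulateᵀ f bs)) (trans (cong (λ t → lookupᵀ t bs) e) (lookup∘tabulateᵀ g bs))

  ≡-decᵀ : ∀ {n A} → DecidableEquality A → DecidableEquality (Table n A)
  ≡-decᵀ {zero}  _≟_ = _≟_
  ≡-decᵀ {suc n} _≟_ = ×P.≡-dec (≡-decᵀ _≟_) (≡-decᵀ _≟_)


module DigitAutomaton where

  open import Data.Bool using (Bool; true; false; not; if_then_else_)
  open import Data.Nat as ℕ using (ℕ; suc)
  open import Data.Vec using (Vec; []; _∷_)
  open import Relation.Binary.PropositionalEquality

  open BinaryDigits
  open BoolTable

  record DigitState : Set where
    constructor state
    field
      onesOdd             : Bool
      trailingOnesEven    : Bool
      lastIsOne           : Bool
      beforeLastZeroIsOne : Bool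

  open DigitState public

  initial : DigitState
  initial = state false true false false

  step : Bool → DigitState → DigitState
  step false (state t q p o) = state t true false p
  step true  (state t q p o) = state (not t) (not q) true o

  digitState : ℕ → DigitState
  digitState = foldBits initial step

  digitState-even : ∀ N → digitState (N ℕ.+ N) ≡ step false (digitState N)
  digitState-even = foldBits-even initial step refl

  digitState-odd : ∀ N → digitState (suc (N ℕ.+ N)) ≡ step true (digitState N)
  digitState-odd = foldBits-odd initial step

  digitState-digit : ∀ b N → digitState (2 ℕ.* N ℕ.+ bit b) ≡ step b (digitState N)
  digitState-digit false N = trans (cong digitState (2*N+0≡N+N N)) (digitState-even N)
  digitState-digit true  N = trans (cong digitState (2*N+1≡1+N+N N)) (digitState-odd N)

  bits : DigitState → Vec Bool 4
  bits (state t q p o) = t ∷ q ∷ p ∷ o ∷ []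

  fromBits : Vec Bool 4 → DigitState
  fromBits (t ∷ q ∷ p ∷ o ∷ []) = state t q p o

  DigitState-≡ : ∀ {A : Set} (f g : DigitState → A) →
                 tabulateᵀ (λ bs → f (fromBits bs)) ≡ tabulateᵀ (λ bs → g (fromBits bs)) → ∀ s → f s ≡ g s
  DigitState-≡ f g e s = tabulateᵀ-≡ (λ bs → f (fromBits bs)) (λ bs → g (fromBits bs)) e (bits s)

  classify : ℕ → ℕ
  classify r = if isOdd r then 1 else r

  Code : Set
  Code = Table 4 ℕ

  ⟦_⟧ᶜ : Code → DigitState → ℕ
  ⟦ c ⟧ᶜ s = lookupᵀ c (bits s)

  afterDigit : Code → Bool → Code
  afterDigit c b = tabulateᵀ (λ bs → ⟦ c ⟧ᶜ (step b (fromBits bs)))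

  afterDigit-correct : ∀ c b s → ⟦ afterDigit c b ⟧ᶜ s ≡ ⟦ c ⟧ᶜ (step b s)
  afterDigit-correct c b s = lookup∘tabulateᵀ (λ bs → ⟦ c ⟧ᶜ (step b (fromBits bs))) (bits s)


module Certificate where

  open import Data.Fin using (Fin; #_)
  open import Data.List using (List; []; _∷_)
  open import Data.Nat using (ℕ)
  open import Data.Product using (_,_)
  open import Data.Vec using (Vec; []; _∷_)

  open DigitAutomaton using (Code)

  size : ℕ
  size = 125

  -- poly is a polynomial with coefficients in [0, 8), next₀ and next₁ are the nodes of nextPoly false poly
  -- and nextPoly true poly, and code gives the class of coeffSeq ⟦ poly ⟧ₙ m as a function of digitState m.
  record Node : Set where
    constructor node
    field
      poly        : List ℕ
      next₀ next₁ : Fin size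
      code        : Code

  code₀ : Code
  code₀ = ((((2 , 2) , (2 , 2)) , ((2 , 2) , (2 , 2))) , (((6 , 6) , (6 , 6)) , ((6 , 6) , (6 , 6))))

  code₁ : Code
  code₁ = ((((2 , 2) , (4 , 4)) , ((2 , 2) , (4 , 4))) , (((6 , 6) , (4 , 4)) , ((6 , 6) , (4 , 4))))

  code₂ : Code
  code₂ = ((((4 , 4) , (2 , 2)) , ((4 , 4) , (2 , 2))) , (((4 , 4) , (6 , 6)) , ((4 , 4) , (6 , 6))))

  code₃ : Code
  code₃ = ((((4 , 4) , (4 , 4)) , ((4 , 4) , (4 , 4))) , (((4 , 4) , (4 , 4)) , ((4 , 4) , (4 , 4))))

  code₄ : Code
  code₄ = ((((4 , 6) , (4 , 6)) , ((1 , 1) , (1 , 1))) , (((4 , 2) , (4 , 2)) , ((1 , 1) , (1 , 1))))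

  code₅ : Code
  code₅ = ((((6 , 4) , (6 , 4)) , ((1 , 1) , (1 , 1))) , (((2 , 4) , (2 , 4)) , ((1 , 1) , (1 , 1))))

  code₆ : Code
  code₆ = ((((6 , 6) , (6 , 6)) , ((6 , 6) , (6 , 6))) , (((2 , 2) , (2 , 2)) , ((2 , 2) , (2 , 2))))

  code₇ : Code
  code₇ = ((((1 , 1) , (1 , 1)) , ((2 , 4) , (2 , 4))) , (((1 , 1) , (1 , 1)) , ((6 , 4) , (6 , 4))))

  code₈ : Code
  code₈ = ((((1 , 1) , (1 , 1)) , ((4 , 2) , (4 , 2))) , (((1 , 1) , (1 , 1)) , ((4 , 6) , (4 , 6))))

  code₉ : Code
  code₉ = ((((1 , 1) , (1 , 1)) , ((1 , 1) , (1 , 1))) , (((1 , 1) , (1 , 1)) , ((1 , 1) , (1 , 1))))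

  nodes : Vec Node size
  nodes =
    node (0 ∷ 0 ∷ 0 ∷ 0 ∷ 7 ∷ 0 ∷ 1 ∷ []) (# 4) (# 5) code₉ ∷
    node (0 ∷ 0 ∷ 0 ∷ 7 ∷ 7 ∷ 0 ∷ 1 ∷ 1 ∷ []) (# 4) (# 6) code₉ ∷
    node (0 ∷ 0 ∷ 7 ∷ 6 ∷ 6 ∷ 0 ∷ 2 ∷ 2 ∷ 1 ∷ []) (# 7) (# 8) code₇ ∷
    node (0 ∷ 7 ∷ 5 ∷ 3 ∷ 4 ∷ 0 ∷ 4 ∷ 5 ∷ 3 ∷ 1 ∷ []) (# 9) (# 10) code₈ ∷
    node (0 ∷ 0 ∷ 0 ∷ 0 ∷ 0 ∷ 7 ∷ 1 ∷ []) (# 11) (# 12) code₉ ∷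
    node (0 ∷ 0 ∷ 0 ∷ 7 ∷ 7 ∷ 7 ∷ 1 ∷ 1 ∷ 1 ∷ []) (# 13) (# 14) code₉ ∷
    node (0 ∷ 0 ∷ 0 ∷ 3 ∷ 7 ∷ 3 ∷ 5 ∷ 1 ∷ 5 ∷ []) (# 15) (# 16) code₉ ∷
    node (0 ∷ 0 ∷ 0 ∷ 0 ∷ 7 ∷ 6 ∷ 2 ∷ 1 ∷ []) (# 17) (# 18) code₁ ∷
    node (0 ∷ 0 ∷ 7 ∷ 4 ∷ 3 ∷ 5 ∷ 3 ∷ 5 ∷ 4 ∷ 1 ∷ []) (# 19) (# 20) code₅ ∷
    node (0 ∷ 0 ∷ 0 ∷ 0 ∷ 5 ∷ 4 ∷ 4 ∷ 3 ∷ []) (# 21) (# 22) code₂ ∷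
    node (0 ∷ 0 ∷ 1 ∷ 2 ∷ 3 ∷ 1 ∷ 7 ∷ 5 ∷ 6 ∷ 7 ∷ []) (# 23) (# 24) code₄ ∷
    node (0 ∷ 0 ∷ 0 ∷ 0 ∷ 0 ∷ 0 ∷ 1 ∷ []) (# 11) (# 25) code₉ ∷
    node (0 ∷ 0 ∷ 0 ∷ 0 ∷ 5 ∷ 2 ∷ 3 ∷ 6 ∷ 1 ∷ []) (# 26) (# 27) code₉ ∷
    node (0 ∷ 0 ∷ 0 ∷ 0 ∷ 0 ∷ 7 ∷ 1 ∷ 1 ∷ []) (# 11) (# 28) code₉ ∷
    node (0 ∷ 0 ∷ 0 ∷ 3 ∷ 3 ∷ 4 ∷ 7 ∷ 0 ∷ 7 ∷ 1 ∷ []) (# 29) (# 30) code₉ ∷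
    node (0 ∷ 0 ∷ 0 ∷ 0 ∷ 0 ∷ 7 ∷ 5 ∷ 5 ∷ []) (# 31) (# 32) code₉ ∷
    node (0 ∷ 0 ∷ 0 ∷ 3 ∷ 7 ∷ 0 ∷ 3 ∷ 4 ∷ 3 ∷ 5 ∷ []) (# 33) (# 34) code₉ ∷
    node (0 ∷ 0 ∷ 0 ∷ 0 ∷ 0 ∷ 7 ∷ 2 ∷ []) (# 35) (# 36) code₀ ∷
    node (0 ∷ 0 ∷ 0 ∷ 7 ∷ 0 ∷ 5 ∷ 4 ∷ 3 ∷ 6 ∷ []) (# 37) (# 38) code₃ ∷
    node (0 ∷ 0 ∷ 0 ∷ 0 ∷ 7 ∷ 3 ∷ 3 ∷ 4 ∷ []) (# 39) (# 40) code₉ ∷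
    node (0 ∷ 0 ∷ 7 ∷ 1 ∷ 2 ∷ 5 ∷ 2 ∷ 1 ∷ 7 ∷ 0 ∷ []) (# 41) (# 42) code₇ ∷
    node (0 ∷ 0 ∷ 0 ∷ 0 ∷ 0 ∷ 5 ∷ 4 ∷ []) (# 43) (# 44) code₃ ∷
    node (0 ∷ 0 ∷ 0 ∷ 5 ∷ 6 ∷ 3 ∷ 6 ∷ 5 ∷ 0 ∷ []) (# 45) (# 46) code₆ ∷
    node (0 ∷ 0 ∷ 0 ∷ 0 ∷ 1 ∷ 3 ∷ 7 ∷ 6 ∷ []) (# 47) (# 48) code₉ ∷
    node (0 ∷ 0 ∷ 1 ∷ 5 ∷ 4 ∷ 3 ∷ 4 ∷ 7 ∷ 7 ∷ 2 ∷ []) (# 49) (# 10) code₈ ∷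
    node (0 ∷ 0 ∷ 0 ∷ 0 ∷ 1 ∷ 2 ∷ 3 ∷ 2 ∷ 1 ∷ []) (# 50) (# 51) code₉ ∷
    node (0 ∷ 0 ∷ 0 ∷ 0 ∷ 0 ∷ 5 ∷ 3 ∷ 1 ∷ []) (# 52) (# 53) code₉ ∷
    node (0 ∷ 0 ∷ 0 ∷ 5 ∷ 5 ∷ 6 ∷ 5 ∷ 6 ∷ 5 ∷ 1 ∷ []) (# 54) (# 55) code₉ ∷
    node (0 ∷ 0 ∷ 0 ∷ 0 ∷ 5 ∷ 6 ∷ 3 ∷ 6 ∷ 5 ∷ []) (# 56) (# 57) code₉ ∷
    node (0 ∷ 0 ∷ 0 ∷ 0 ∷ 0 ∷ 3 ∷ 7 ∷ 7 ∷ []) (# 58) (# 59) code₉ ∷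
    node (0 ∷ 0 ∷ 0 ∷ 7 ∷ 5 ∷ 6 ∷ 1 ∷ 6 ∷ 5 ∷ 3 ∷ []) (# 60) (# 61) code₉ ∷
    node (0 ∷ 0 ∷ 0 ∷ 0 ∷ 0 ∷ 0 ∷ 5 ∷ []) (# 31) (# 62) code₉ ∷
    node (0 ∷ 0 ∷ 0 ∷ 0 ∷ 1 ∷ 6 ∷ 7 ∷ 6 ∷ 1 ∷ []) (# 63) (# 64) code₉ ∷
    node (0 ∷ 0 ∷ 0 ∷ 0 ∷ 0 ∷ 7 ∷ 3 ∷ 3 ∷ []) (# 52) (# 53) code₉ ∷
    node (0 ∷ 0 ∷ 0 ∷ 3 ∷ 1 ∷ 6 ∷ 5 ∷ 6 ∷ 1 ∷ 7 ∷ []) (# 65) (# 66) code₉ ∷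
    node (0 ∷ 0 ∷ 0 ∷ 0 ∷ 0 ∷ 0 ∷ 2 ∷ []) (# 35) (# 67) code₀ ∷
    node (0 ∷ 0 ∷ 0 ∷ 0 ∷ 6 ∷ 4 ∷ 6 ∷ 0 ∷ 2 ∷ []) (# 68) (# 69) code₆ ∷
    node (0 ∷ 0 ∷ 0 ∷ 0 ∷ 0 ∷ 0 ∷ 4 ∷ 6 ∷ []) (# 43) (# 70) code₃ ∷
    node (0 ∷ 0 ∷ 0 ∷ 4 ∷ 0 ∷ 2 ∷ 4 ∷ 6 ∷ 4 ∷ 6 ∷ []) (# 71) (# 72) code₃ ∷
    node (0 ∷ 0 ∷ 0 ∷ 0 ∷ 0 ∷ 7 ∷ 3 ∷ []) (# 52) (# 73) code₉ ∷
    node (0 ∷ 0 ∷ 0 ∷ 7 ∷ 5 ∷ 3 ∷ 7 ∷ 1 ∷ 3 ∷ []) (# 74) (# 75) code₉ ∷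
    node (0 ∷ 0 ∷ 0 ∷ 0 ∷ 7 ∷ 2 ∷ 2 ∷ 7 ∷ []) (# 17) (# 18) code₁ ∷
    node (0 ∷ 0 ∷ 7 ∷ 4 ∷ 7 ∷ 3 ∷ 3 ∷ 7 ∷ 4 ∷ 7 ∷ []) (# 76) (# 77) code₅ ∷
    node (0 ∷ 0 ∷ 0 ∷ 0 ∷ 0 ∷ 0 ∷ 4 ∷ []) (# 43) (# 70) code₃ ∷
    node (0 ∷ 0 ∷ 0 ∷ 0 ∷ 0 ∷ 0 ∷ 4 ∷ 4 ∷ 4 ∷ []) (# 71) (# 72) code₃ ∷
    node (0 ∷ 0 ∷ 0 ∷ 0 ∷ 0 ∷ 6 ∷ 6 ∷ 0 ∷ []) (# 78) (# 79) code₆ ∷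
    node (0 ∷ 0 ∷ 0 ∷ 2 ∷ 6 ∷ 2 ∷ 2 ∷ 6 ∷ 2 ∷ 0 ∷ []) (# 80) (# 81) code₀ ∷
    node (0 ∷ 0 ∷ 0 ∷ 0 ∷ 0 ∷ 1 ∷ 7 ∷ []) (# 58) (# 82) code₉ ∷
    node (0 ∷ 0 ∷ 0 ∷ 1 ∷ 5 ∷ 1 ∷ 7 ∷ 3 ∷ 7 ∷ []) (# 83) (# 84) code₉ ∷
    node (0 ∷ 0 ∷ 0 ∷ 0 ∷ 1 ∷ 4 ∷ 4 ∷ 7 ∷ []) (# 85) (# 86) code₂ ∷
    node (0 ∷ 0 ∷ 0 ∷ 0 ∷ 0 ∷ 1 ∷ 3 ∷ 1 ∷ []) (# 52) (# 53) code₉ ∷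
    node (0 ∷ 0 ∷ 0 ∷ 1 ∷ 5 ∷ 2 ∷ 5 ∷ 2 ∷ 5 ∷ 1 ∷ []) (# 54) (# 55) code₉ ∷
    node (0 ∷ 0 ∷ 0 ∷ 0 ∷ 0 ∷ 0 ∷ 3 ∷ []) (# 52) (# 87) code₉ ∷
    node (0 ∷ 0 ∷ 0 ∷ 0 ∷ 7 ∷ 2 ∷ 1 ∷ 2 ∷ 7 ∷ []) (# 88) (# 89) code₉ ∷
    node (0 ∷ 0 ∷ 0 ∷ 0 ∷ 0 ∷ 5 ∷ 5 ∷ 5 ∷ []) (# 31) (# 32) code₉ ∷
    node (0 ∷ 0 ∷ 0 ∷ 1 ∷ 7 ∷ 6 ∷ 3 ∷ 6 ∷ 7 ∷ 1 ∷ []) (# 90) (# 91) code₉ ∷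
    node (0 ∷ 0 ∷ 0 ∷ 0 ∷ 0 ∷ 5 ∷ 3 ∷ 5 ∷ []) (# 52) (# 53) code₉ ∷
    node (0 ∷ 0 ∷ 0 ∷ 5 ∷ 5 ∷ 2 ∷ 5 ∷ 2 ∷ 5 ∷ 5 ∷ []) (# 54) (# 55) code₉ ∷
    node (0 ∷ 0 ∷ 0 ∷ 0 ∷ 0 ∷ 0 ∷ 7 ∷ []) (# 58) (# 92) code₉ ∷
    node (0 ∷ 0 ∷ 0 ∷ 0 ∷ 3 ∷ 2 ∷ 5 ∷ 2 ∷ 3 ∷ []) (# 93) (# 94) code₉ ∷
    node (0 ∷ 0 ∷ 0 ∷ 0 ∷ 0 ∷ 5 ∷ 1 ∷ 5 ∷ []) (# 11) (# 28) code₉ ∷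
    node (0 ∷ 0 ∷ 0 ∷ 1 ∷ 3 ∷ 6 ∷ 7 ∷ 6 ∷ 3 ∷ 1 ∷ []) (# 95) (# 96) code₉ ∷
    node (0 ∷ 0 ∷ 0 ∷ 0 ∷ 5 ∷ 2 ∷ 7 ∷ 2 ∷ 5 ∷ []) (# 97) (# 98) code₉ ∷
    node (0 ∷ 0 ∷ 0 ∷ 0 ∷ 0 ∷ 1 ∷ 7 ∷ 1 ∷ []) (# 58) (# 59) code₉ ∷
    node (0 ∷ 0 ∷ 0 ∷ 1 ∷ 1 ∷ 2 ∷ 1 ∷ 2 ∷ 1 ∷ 1 ∷ []) (# 99) (# 100) code₉ ∷
    node (0 ∷ 0 ∷ 0 ∷ 0 ∷ 0 ∷ 1 ∷ 5 ∷ 1 ∷ []) (# 31) (# 32) code₉ ∷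
    node (0 ∷ 0 ∷ 0 ∷ 5 ∷ 7 ∷ 6 ∷ 3 ∷ 6 ∷ 7 ∷ 5 ∷ []) (# 90) (# 91) code₉ ∷
    node (0 ∷ 0 ∷ 0 ∷ 0 ∷ 2 ∷ 4 ∷ 6 ∷ 4 ∷ 2 ∷ []) (# 101) (# 102) code₆ ∷
    node (0 ∷ 0 ∷ 0 ∷ 0 ∷ 0 ∷ 6 ∷ 6 ∷ 2 ∷ []) (# 78) (# 79) code₆ ∷
    node (0 ∷ 0 ∷ 0 ∷ 6 ∷ 2 ∷ 0 ∷ 2 ∷ 0 ∷ 2 ∷ 2 ∷ []) (# 103) (# 104) code₀ ∷
    node (0 ∷ 0 ∷ 0 ∷ 0 ∷ 4 ∷ 0 ∷ 4 ∷ 0 ∷ 4 ∷ []) (# 105) (# 106) code₃ ∷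
    node (0 ∷ 0 ∷ 0 ∷ 0 ∷ 0 ∷ 0 ∷ 4 ∷ 4 ∷ []) (# 43) (# 70) code₃ ∷
    node (0 ∷ 0 ∷ 0 ∷ 0 ∷ 4 ∷ 4 ∷ 4 ∷ 4 ∷ 4 ∷ 4 ∷ []) (# 105) (# 106) code₃ ∷
    node (0 ∷ 0 ∷ 0 ∷ 0 ∷ 7 ∷ 6 ∷ 1 ∷ 2 ∷ 3 ∷ []) (# 107) (# 108) code₉ ∷
    node (0 ∷ 0 ∷ 0 ∷ 0 ∷ 0 ∷ 5 ∷ 7 ∷ 3 ∷ []) (# 58) (# 59) code₉ ∷
    node (0 ∷ 0 ∷ 0 ∷ 1 ∷ 5 ∷ 4 ∷ 1 ∷ 0 ∷ 1 ∷ 3 ∷ []) (# 109) (# 110) code₉ ∷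
    node (0 ∷ 0 ∷ 0 ∷ 0 ∷ 7 ∷ 7 ∷ 3 ∷ 4 ∷ []) (# 39) (# 40) code₉ ∷
    node (0 ∷ 0 ∷ 7 ∷ 5 ∷ 2 ∷ 1 ∷ 2 ∷ 5 ∷ 7 ∷ 0 ∷ []) (# 41) (# 42) code₇ ∷
    node (0 ∷ 0 ∷ 0 ∷ 0 ∷ 0 ∷ 0 ∷ 6 ∷ []) (# 78) (# 79) code₆ ∷
    node (0 ∷ 0 ∷ 0 ∷ 0 ∷ 6 ∷ 4 ∷ 2 ∷ 4 ∷ 6 ∷ []) (# 111) (# 112) code₀ ∷
    node (0 ∷ 0 ∷ 0 ∷ 0 ∷ 0 ∷ 6 ∷ 2 ∷ 2 ∷ []) (# 35) (# 67) code₀ ∷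
    node (0 ∷ 0 ∷ 0 ∷ 6 ∷ 6 ∷ 0 ∷ 6 ∷ 0 ∷ 6 ∷ 2 ∷ []) (# 113) (# 114) code₆ ∷
    node (0 ∷ 0 ∷ 0 ∷ 0 ∷ 3 ∷ 6 ∷ 5 ∷ 2 ∷ 7 ∷ []) (# 115) (# 116) code₉ ∷
    node (0 ∷ 0 ∷ 0 ∷ 0 ∷ 0 ∷ 5 ∷ 7 ∷ 7 ∷ []) (# 58) (# 59) code₉ ∷
    node (0 ∷ 0 ∷ 0 ∷ 1 ∷ 5 ∷ 0 ∷ 1 ∷ 4 ∷ 1 ∷ 7 ∷ []) (# 109) (# 110) code₉ ∷
    node (0 ∷ 0 ∷ 0 ∷ 0 ∷ 0 ∷ 1 ∷ 4 ∷ []) (# 43) (# 44) code₃ ∷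
    node (0 ∷ 0 ∷ 0 ∷ 1 ∷ 6 ∷ 7 ∷ 6 ∷ 1 ∷ 0 ∷ []) (# 45) (# 46) code₆ ∷
    node (0 ∷ 0 ∷ 0 ∷ 0 ∷ 3 ∷ 6 ∷ 1 ∷ 6 ∷ 3 ∷ []) (# 117) (# 118) code₉ ∷
    node (0 ∷ 0 ∷ 0 ∷ 0 ∷ 0 ∷ 7 ∷ 1 ∷ 7 ∷ []) (# 11) (# 28) code₉ ∷
    node (0 ∷ 0 ∷ 0 ∷ 7 ∷ 7 ∷ 6 ∷ 7 ∷ 6 ∷ 7 ∷ 7 ∷ []) (# 119) (# 120) code₉ ∷
    node (0 ∷ 0 ∷ 0 ∷ 0 ∷ 0 ∷ 7 ∷ 3 ∷ 7 ∷ []) (# 52) (# 53) code₉ ∷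
    node (0 ∷ 0 ∷ 0 ∷ 3 ∷ 1 ∷ 2 ∷ 5 ∷ 2 ∷ 1 ∷ 3 ∷ []) (# 65) (# 66) code₉ ∷
    node (0 ∷ 0 ∷ 0 ∷ 0 ∷ 7 ∷ 6 ∷ 5 ∷ 6 ∷ 7 ∷ []) (# 121) (# 122) code₉ ∷
    node (0 ∷ 0 ∷ 0 ∷ 0 ∷ 0 ∷ 3 ∷ 5 ∷ 3 ∷ []) (# 31) (# 32) code₉ ∷
    node (0 ∷ 0 ∷ 0 ∷ 3 ∷ 3 ∷ 6 ∷ 3 ∷ 6 ∷ 3 ∷ 3 ∷ []) (# 123) (# 124) code₉ ∷
    node (0 ∷ 0 ∷ 0 ∷ 0 ∷ 0 ∷ 3 ∷ 7 ∷ 3 ∷ []) (# 58) (# 59) code₉ ∷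
    node (0 ∷ 0 ∷ 0 ∷ 7 ∷ 5 ∷ 2 ∷ 1 ∷ 2 ∷ 5 ∷ 7 ∷ []) (# 60) (# 61) code₉ ∷
    node (0 ∷ 0 ∷ 0 ∷ 0 ∷ 0 ∷ 5 ∷ 7 ∷ 5 ∷ []) (# 58) (# 59) code₉ ∷
    node (0 ∷ 0 ∷ 0 ∷ 5 ∷ 1 ∷ 2 ∷ 1 ∷ 2 ∷ 1 ∷ 5 ∷ []) (# 99) (# 100) code₉ ∷
    node (0 ∷ 0 ∷ 0 ∷ 0 ∷ 0 ∷ 1 ∷ 1 ∷ 1 ∷ []) (# 11) (# 28) code₉ ∷
    node (0 ∷ 0 ∷ 0 ∷ 5 ∷ 3 ∷ 6 ∷ 7 ∷ 6 ∷ 3 ∷ 5 ∷ []) (# 95) (# 96) code₉ ∷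
    node (0 ∷ 0 ∷ 0 ∷ 0 ∷ 0 ∷ 2 ∷ 6 ∷ 2 ∷ []) (# 78) (# 79) code₆ ∷
    node (0 ∷ 0 ∷ 0 ∷ 2 ∷ 2 ∷ 4 ∷ 2 ∷ 4 ∷ 2 ∷ 2 ∷ []) (# 103) (# 104) code₀ ∷
    node (0 ∷ 0 ∷ 0 ∷ 0 ∷ 0 ∷ 2 ∷ 2 ∷ 2 ∷ []) (# 35) (# 67) code₀ ∷
    node (0 ∷ 0 ∷ 0 ∷ 2 ∷ 6 ∷ 4 ∷ 6 ∷ 4 ∷ 6 ∷ 2 ∷ []) (# 113) (# 114) code₆ ∷
    node (0 ∷ 0 ∷ 0 ∷ 0 ∷ 0 ∷ 4 ∷ 4 ∷ 4 ∷ []) (# 43) (# 70) code₃ ∷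
    node (0 ∷ 0 ∷ 0 ∷ 4 ∷ 4 ∷ 0 ∷ 4 ∷ 0 ∷ 4 ∷ 4 ∷ []) (# 105) (# 106) code₃ ∷
    node (0 ∷ 0 ∷ 0 ∷ 0 ∷ 0 ∷ 7 ∷ 1 ∷ 3 ∷ []) (# 11) (# 28) code₉ ∷
    node (0 ∷ 0 ∷ 0 ∷ 7 ∷ 7 ∷ 2 ∷ 7 ∷ 2 ∷ 7 ∷ 3 ∷ []) (# 119) (# 120) code₉ ∷
    node (0 ∷ 0 ∷ 0 ∷ 0 ∷ 0 ∷ 5 ∷ 1 ∷ 1 ∷ []) (# 11) (# 28) code₉ ∷
    node (0 ∷ 0 ∷ 0 ∷ 1 ∷ 3 ∷ 2 ∷ 7 ∷ 2 ∷ 3 ∷ 5 ∷ []) (# 95) (# 96) code₉ ∷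
    node (0 ∷ 0 ∷ 0 ∷ 0 ∷ 0 ∷ 6 ∷ 2 ∷ 6 ∷ []) (# 35) (# 67) code₀ ∷
    node (0 ∷ 0 ∷ 0 ∷ 6 ∷ 6 ∷ 4 ∷ 6 ∷ 4 ∷ 6 ∷ 6 ∷ []) (# 113) (# 114) code₆ ∷
    node (0 ∷ 0 ∷ 0 ∷ 0 ∷ 0 ∷ 6 ∷ 6 ∷ 6 ∷ []) (# 78) (# 79) code₆ ∷
    node (0 ∷ 0 ∷ 0 ∷ 6 ∷ 2 ∷ 4 ∷ 2 ∷ 4 ∷ 2 ∷ 6 ∷ []) (# 103) (# 104) code₀ ∷
    node (0 ∷ 0 ∷ 0 ∷ 0 ∷ 0 ∷ 3 ∷ 5 ∷ 7 ∷ []) (# 31) (# 32) code₉ ∷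
    node (0 ∷ 0 ∷ 0 ∷ 3 ∷ 3 ∷ 2 ∷ 3 ∷ 2 ∷ 3 ∷ 7 ∷ []) (# 123) (# 124) code₉ ∷
    node (0 ∷ 0 ∷ 0 ∷ 0 ∷ 0 ∷ 3 ∷ 1 ∷ 3 ∷ []) (# 11) (# 28) code₉ ∷
    node (0 ∷ 0 ∷ 0 ∷ 3 ∷ 7 ∷ 6 ∷ 7 ∷ 6 ∷ 7 ∷ 3 ∷ []) (# 119) (# 120) code₉ ∷
    node (0 ∷ 0 ∷ 0 ∷ 0 ∷ 0 ∷ 7 ∷ 7 ∷ 7 ∷ []) (# 58) (# 59) code₉ ∷
    node (0 ∷ 0 ∷ 0 ∷ 3 ∷ 5 ∷ 2 ∷ 1 ∷ 2 ∷ 5 ∷ 3 ∷ []) (# 60) (# 61) code₉ ∷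
    node (0 ∷ 0 ∷ 0 ∷ 0 ∷ 0 ∷ 7 ∷ 5 ∷ 7 ∷ []) (# 31) (# 32) code₉ ∷
    node (0 ∷ 0 ∷ 0 ∷ 7 ∷ 3 ∷ 6 ∷ 3 ∷ 6 ∷ 3 ∷ 7 ∷ []) (# 123) (# 124) code₉ ∷
    node (0 ∷ 0 ∷ 0 ∷ 0 ∷ 0 ∷ 3 ∷ 3 ∷ 3 ∷ []) (# 52) (# 53) code₉ ∷
    node (0 ∷ 0 ∷ 0 ∷ 7 ∷ 1 ∷ 2 ∷ 5 ∷ 2 ∷ 1 ∷ 7 ∷ []) (# 65) (# 66) code₉ ∷
    []


module Simulation where

  open import Data.Bool using (Bool; true; false)
  open import Data.Fin using (Fin)
  open import Data.Fin.Properties using (all?)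
  open import Data.Integer using (+_; 0ℤ)
  import Data.Integer.Properties as ℤP
  open import Data.List using (List)
  import Data.List.Properties as ListP
  open import Data.Nat as ℕ using (ℕ; suc; _<_)
  import Data.Nat.Properties as ℕP
  open import Data.Product using (Σ-syntax; _×_; _,_; proj₁; proj₂)
  open import Data.Vec using (lookup)
  open import Relation.Nullary using (Dec)
  open import Relation.Nullary.Decidable using (_×-dec_; toWitness)
  open import Relation.Binary.PropositionalEquality

  open PowerSeries using (⊛-identityˡ)
  open BinaryDigits
  open BoolTable
  open CongruenceMod
  open CoefficientSequence
  open Polynomial
  open DigitAutomaton
  open Certificate

  polyAt : Fin size → List ℕ
  polyAt i = Node.poly (lookup nodes i)

  codeAt : Fin size → Code
  codeAt i = Node.code (lookup nodes i)

  next : Fin size → Bool → Fin size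
  next i false = Node.next₀ (lookup nodes i)
  next i true  = Node.next₁ (lookup nodes i)

  ValidStep : Fin size → Bool → Set
  ValidStep i b = nextPoly b (polyAt i) ≡ polyAt (next i b) × afterDigit (codeAt i) b ≡ codeAt (next i b)

  ValidOutput : Fin size → Set
  ValidOutput i = coeffℕ (polyAt i) 6 < 8 × classify (coeffℕ (polyAt i) 6) ≡ ⟦ codeAt i ⟧ᶜ initial

  Valid : Fin size → Set
  Valid i = ValidStep i false × ValidStep i true × ValidOutput i

  valid? : ∀ i → Dec (Valid i)
  valid? i = validStep? false ×-dec validStep? true ×-dec validOutput?
    where
    validStep? : ∀ b → Dec (ValidStep i b)
    validStep? b = ListP.≡-dec ℕP._≟_ _ _ ×-dec ≡-decᵀ ℕP._≟_ _ _
    validOutput? : Dec (ValidOutput i)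
    validOutput? = coeffℕ (polyAt i) 6 ℕP.<? 8 ×-dec classify (coeffℕ (polyAt i) 6) ℕP.≟ ⟦ codeAt i ⟧ᶜ initial

  valid : ∀ i → Valid i
  valid = toWitness {a? = all? valid?} _

  validStep : ∀ i b → ValidStep i b
  validStep i false = proj₁ (valid i)
  validStep i true  = proj₁ (proj₂ (valid i))

  Invariant : ℕ → Fin size → Set
  Invariant m i = Σ[ r ∈ ℕ ] r < 8 × coeffSeq ⟦ polyAt i ⟧ₙ m ≡ + r [modℤ + 8 ] ×
                             classify r ≡ ⟦ codeAt i ⟧ᶜ (digitState m)

  invariant-0 : ∀ i → Invariant 0 i
  invariant-0 i =
    coeffℕ (polyAt i) 6 , proj₁ (proj₂ (proj₂ (valid i))) ,
    (0ℤ , trans (⊛-identityˡ ⟦ polyAt i ⟧ₙ 6) (trans (⟦⟧ₙ-coeff (polyAt i) 6) (sym (ℤP.+-identityʳ _)))) ,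
    proj₂ (proj₂ (proj₂ (valid i)))

  invariant-digit : ∀ b N → (∀ i → Invariant N i) → ∀ i → Invariant (2 ℕ.* N ℕ.+ bit b) i
  invariant-digit b N inv i with inv (next i b)
  ... | r , r<8 , seq≡r , class≡code =
    r , r<8 ,
    ≡-modℤ-trans (subst (λ R → coeffSeq ⟦ polyAt i ⟧ₙ (2 ℕ.* N ℕ.+ bit b) ≡ coeffSeq ⟦ R ⟧ₙ N [modℤ + 8 ])
                        (proj₁ (validStep i b)) (coeffSeq-nextPoly (polyAt i) N b))
                 seq≡r ,
    (begin
      classify r                                       ≡⟨ class≡code ⟩
      ⟦ codeAt (next i b) ⟧ᶜ (digitState N)            ≡⟨ cong (λ c → ⟦ c ⟧ᶜ (digitState N)) (proj₂ (validStep i b)) ⟨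
      ⟦ afterDigit (codeAt i) b ⟧ᶜ (digitState N)      ≡⟨ afterDigit-correct (codeAt i) b (digitState N) ⟩
      ⟦ codeAt i ⟧ᶜ (step b (digitState N))            ≡⟨ cong ⟦ codeAt i ⟧ᶜ (digitState-digit b N) ⟨
      ⟦ codeAt i ⟧ᶜ (digitState (2 ℕ.* N ℕ.+ bit b))   ∎)
    where open ≡-Reasoning

  invariant : ∀ m i → Invariant m i
  invariant = binary-induction (λ m → ∀ i → Invariant m i) invariant-0
    (λ N inv → subst (λ m → ∀ i → Invariant m i) (2*N+0≡N+N (suc N)) (invariant-digit false (suc N) inv))
    (λ N inv → subst (λ m → ∀ i → Invariant m i) (2*N+1≡1+N+N N) (invariant-digit true N inv))


module MotzkinMod8 where

  open import Data.Empty using (⊥-elim)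
  open import Data.Fin using (Fin; toℕ; _↑ˡ_)
  open import Data.Fin.Properties using (toℕ<n)
  open import Data.Fin.Patterns using (0F; 1F; 2F; 3F)
  open import Data.Integer using (ℤ; +_; -[1+_]; -1ℤ; _+_; _*_; -_; _-_)
  import Data.Integer.Properties as ℤP
  open import Data.Integer.Tactic.RingSolver using (solve-∀)
  open import Data.List using (List)
  open import Data.Nat as ℕ using (ℕ; suc; _≤_; _<_; _∸_; _%_)
  import Data.Nat.Properties as ℕP
  open import Data.Nat.DivMod using ([m+kn]%n≡m%n; m<n⇒m%n≡m)
  import Data.Nat.Tactic.RingSolver as NS
  open import Data.Product using (_,_)
  open import Relation.Binary.PropositionalEquality
  open import Defs using (motzkin)

  open PowerSeries
  open Trinomial using (P; motzkin≡P^n[n]-P^n[n+2])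
  open CongruenceMod
  open CoefficientSequence
  open Polynomial
  open DigitAutomaton
  open Certificate using (size)
  open Simulation

  initialSeries : ℕ → Series
  initialSeries s = shiftBy (6 ∸ s) (P ^ s) ⊕ scale -1ℤ (shiftBy (4 ∸ s) (P ^ s))

  coeffSeq-initialSeries : ∀ s m → s ≤ 4 → coeffSeq (initialSeries s) m ≡ + motzkin (4 ℕ.* m ℕ.+ s)
  coeffSeq-initialSeries s m s≤4 = begin
      (G ⊛ (shiftBy (6 ∸ s) (P ^ s) ⊕ scale -1ℤ (shiftBy (4 ∸ s) (P ^ s)))) i
    ≡⟨ ⊛-distribˡ G (shiftBy (6 ∸ s) (P ^ s)) (scale -1ℤ (shiftBy (4 ∸ s) (P ^ s))) i ⟩
      (G ⊛ shiftBy (6 ∸ s) (P ^ s)) i + (G ⊛ scale -1ℤ (shiftBy (4 ∸ s) (P ^ s))) i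
    ≡⟨ cong (_+_ ((G ⊛ shiftBy (6 ∸ s) (P ^ s)) i)) (⊛-scaleʳ -1ℤ G (shiftBy (4 ∸ s) (P ^ s)) i) ⟩
      (G ⊛ shiftBy (6 ∸ s) (P ^ s)) i + -1ℤ * (G ⊛ shiftBy (4 ∸ s) (P ^ s)) i
    ≡⟨ cong₂ (λ a b → a + -1ℤ * b)
             (trans (cong (G ⊛ shiftBy (6 ∸ s) (P ^ s)) i≡[6∸s]+n) (⊛-shiftBy-+ (6 ∸ s) G (P ^ s) n))
             (trans (cong (G ⊛ shiftBy (4 ∸ s) (P ^ s)) i≡[4∸s]+[n+2]) (⊛-shiftBy-+ (4 ∸ s) G (P ^ s) (n ℕ.+ 2))) ⟩
      (G ⊛ P ^ s) n + -1ℤ * (G ⊛ P ^ s) (n ℕ.+ 2)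
    ≡⟨ cong₂ (λ a b → a + -1ℤ * b) (^-homo-* P (4 ℕ.* m) s n) (^-homo-* P (4 ℕ.* m) s (n ℕ.+ 2)) ⟨
      (P ^ n) n + -1ℤ * (P ^ n) (n ℕ.+ 2)
    ≡⟨ minus ((P ^ n) n) ((P ^ n) (n ℕ.+ 2)) ⟩
      (P ^ n) n - (P ^ n) (n ℕ.+ 2)
    ≡⟨ motzkin≡P^n[n]-P^n[n+2] n ⟨
      + motzkin n
    ∎
    where
    open ≡-Reasoning
    G = P ^ (4 ℕ.* m)
    n = 4 ℕ.* m ℕ.+ s
    i = 4 ℕ.* m ℕ.+ 6
    s≤6 : s ≤ 6
    s≤6 = ℕP.≤-trans s≤4 (ℕP.m≤m+n 4 2)
    i≡[6∸s]+n : i ≡ (6 ∸ s) ℕ.+ n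
    i≡[6∸s]+n = trans (cong (4 ℕ.* m ℕ.+_) (sym (ℕP.m∸n+n≡m s≤6))) (regroup (4 ℕ.* m) (6 ∸ s) s)
      where
      regroup : ∀ k t s → k ℕ.+ (t ℕ.+ s) ≡ t ℕ.+ (k ℕ.+ s)
      regroup = NS.solve-∀
    i≡[4∸s]+[n+2] : i ≡ (4 ∸ s) ℕ.+ (n ℕ.+ 2)
    i≡[4∸s]+[n+2] =
      trans (cong (λ z → 4 ℕ.* m ℕ.+ (z ℕ.+ 2)) (sym (ℕP.m∸n+n≡m s≤4))) (regroup (4 ℕ.* m) (4 ∸ s) s)
      where
      regroup : ∀ k t s → k ℕ.+ ((t ℕ.+ s) ℕ.+ 2) ≡ t ℕ.+ ((k ℕ.+ s) ℕ.+ 2)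
      regroup = NS.solve-∀
    minus : ∀ a b → a + -1ℤ * b ≡ a - b
    minus = solve-∀

  initialPoly : ℕ → List ℤ
  initialPoly s = shiftByᴾ (6 ∸ s) (Pᴾ ^ᴾ s) +ᴾ scaleᴾ -1ℤ (shiftByᴾ (4 ∸ s) (Pᴾ ^ᴾ s))

  ⟦initialPoly⟧ : ∀ s → ⟦ initialPoly s ⟧ ≈ initialSeries s
  ⟦initialPoly⟧ s =
    ≈-trans (⟦⟧-+ (shiftByᴾ (6 ∸ s) (Pᴾ ^ᴾ s)) (scaleᴾ -1ℤ (shiftByᴾ (4 ∸ s) (Pᴾ ^ᴾ s))))
            (⊕-cong (⟦shiftBy⟧ (6 ∸ s))
                    (≈-trans (⟦⟧-scale -1ℤ (shiftByᴾ (4 ∸ s) (Pᴾ ^ᴾ s))) (λ n → cong (-1ℤ *_) (⟦shiftBy⟧ (4 ∸ s) n))))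
    where
    ⟦shiftBy⟧ : ∀ k → ⟦ shiftByᴾ k (Pᴾ ^ᴾ s) ⟧ ≈ shiftBy k (P ^ s)
    ⟦shiftBy⟧ k = ≈-trans (⟦⟧-shiftBy k (Pᴾ ^ᴾ s)) (shiftBy-cong k (≈-trans (⟦⟧-^ Pᴾ s) (^-congˡ s ⟦Pᴾ⟧)))

  initialNode : Fin 4 → Fin size
  initialNode s = s ↑ˡ 121

  initialNode-poly : ∀ s → mod8 (initialPoly (toℕ s)) ≡ polyAt (initialNode s)
  initialNode-poly 0F = refl
  initialNode-poly 1F = refl
  initialNode-poly 2F = refl
  initialNode-poly 3F = refl

  %8-from-≡-modℤ : ∀ M r → r < 8 → + M ≡ + r [modℤ + 8 ] → M % 8 ≡ r
  %8-from-≡-modℤ M r r<8 (+ k , M≡r+8k) =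
    trans (cong (_% 8) (ℤP.+-injective (trans M≡r+8k (sym pos-r+k*8))))
          (trans ([m+kn]%n≡m%n r k 8) (m<n⇒m%n≡m r<8))
    where
    pos-r+k*8 : + (r ℕ.+ k ℕ.* 8) ≡ + r + + 8 * + k
    pos-r+k*8 = trans (ℤP.pos-+ r (k ℕ.* 8)) (cong (_+_ (+ r)) (trans (ℤP.pos-* k 8) (ℤP.*-comm (+ k) (+ 8))))
  %8-from-≡-modℤ M r r<8 (-[1+ k ] , M≡r+8q) = ⊥-elim (ℕP.<⇒≱ r<8 8≤r)
    where
    M+8[1+k]≡r : M ℕ.+ 8 ℕ.* suc k ≡ r
    M+8[1+k]≡r = ℤP.+-injective (trans (cong (_+ + 8 * + suc k) M≡r+8q) (cancel (+ r) (+ suc k)))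
      where
      cancel : ∀ r q → r + + 8 * (- q) + + 8 * q ≡ r
      cancel = solve-∀
    8≤r : 8 ≤ r
    8≤r = subst (8 ≤_) M+8[1+k]≡r (ℕP.≤-trans (ℕP.m≤m*n 8 (suc k)) (ℕP.m≤n+m (8 ℕ.* suc k) M))

  classify-motzkin : ∀ m s → classify (motzkin (4 ℕ.* m ℕ.+ toℕ s) % 8) ≡ ⟦ codeAt (initialNode s) ⟧ᶜ (digitState m)
  classify-motzkin m s = from-invariant (invariant m (initialNode s))
    where
    motzkin≡seq : + motzkin (4 ℕ.* m ℕ.+ toℕ s) ≡ coeffSeq ⟦ polyAt (initialNode s) ⟧ₙ m [modℤ + 8 ]
    motzkin≡seq =
      subst₂ (λ a R → a ≡ coeffSeq ⟦ R ⟧ₙ m [modℤ + 8 ])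
             (coeffSeq-initialSeries (toℕ s) m (ℕP.<⇒≤ (toℕ<n s)))
             (initialNode-poly s)
             (coeffSeq-≋ (≋-respˡ (≈-sym (⟦initialPoly⟧ (toℕ s))) (⟦⟧-mod8 (initialPoly (toℕ s)))) m)
    from-invariant : Invariant m (initialNode s) →
                     classify (motzkin (4 ℕ.* m ℕ.+ toℕ s) % 8) ≡ ⟦ codeAt (initialNode s) ⟧ᶜ (digitState m)
    from-invariant (r , r<8 , seq≡r , class≡code) =
      trans (cong classify (%8-from-≡-modℤ _ r r<8 (≡-modℤ-trans motzkin≡seq seq≡r))) class≡code


module DigitSums where

  open import Data.Bool using (true; false; not; if_then_else_)
  open import Data.Integer using (ℤ; +_; 0ℤ; -1ℤ; _+_; _*_; -_; _-_; ∣_∣)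
  import Data.Integer.Properties as ℤP
  open import Data.Integer.Tactic.RingSolver using (solve-∀)
  open import Data.Nat as ℕ using (ℕ; suc; _≤_; z≤n; s≤s)
  import Data.Nat.Properties as ℕP
  open import Function using (_∘_)
  open import Relation.Binary.PropositionalEquality

  open FiniteSum
  open BinaryDigits
  open DigitAutomaton

  evenRun : DigitState → ℤ
  evenRun s = if trailingOnesEven s then + 1 else 0ℤ

  sign : DigitState → ℤ
  sign s = if onesOdd s then -1ℤ else + 1

  evenRun-even : ∀ N → evenRun (digitState (N ℕ.+ N)) ≡ + 1
  evenRun-even N = cong evenRun (digitState-even N)

  evenRun-odd : ∀ N → evenRun (digitState (suc (N ℕ.+ N))) ≡ + 1 - evenRun (digitState N)
  evenRun-odd N = trans (cong evenRun (digitState-odd N)) (flip (trailingOnesEven (digitState N)))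
    where
    flip : ∀ b → (if not b then + 1 else 0ℤ) ≡ + 1 - (if b then + 1 else 0ℤ)
    flip true  = refl
    flip false = refl

  sign-even : ∀ N → sign (digitState (N ℕ.+ N)) ≡ sign (digitState N)
  sign-even N = cong sign (digitState-even N)

  sign-odd : ∀ N → sign (digitState (suc (N ℕ.+ N))) ≡ - sign (digitState N)
  sign-odd N = trans (cong sign (digitState-odd N)) (flip (onesOdd (digitState N)))
    where
    flip : ∀ b → (if not b then -1ℤ else + 1) ≡ - (if b then -1ℤ else + 1)
    flip true  = refl
    flip false = refl

  ∣sign∣ : ∀ s → ∣ sign s ∣ ≡ 1
  ∣sign∣ s with onesOdd s
  ... | true  = refl
  ... | false = refl

  E : ℕ → ℤ
  E = Σ< (evenRun ∘ digitState)

  D : ℕ → ℤ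
  D = Σ< (λ m → evenRun (digitState m) * sign (digitState m))

  e : ℕ → ℤ
  e K = + 3 * E K - + 2 * + K

  E-even : ∀ N → E (N ℕ.+ N) ≡ + N + (+ N - E N)
  E-even N = begin
      E (N ℕ.+ N)
    ≡⟨ Σ<-evens-odds _ N ⟩
      Σ< (λ j → evenRun (digitState (j ℕ.+ j))) N + Σ< (λ j → evenRun (digitState (suc (j ℕ.+ j)))) N
    ≡⟨ cong₂ _+_ (trans (Σ<-cong N evenRun-even) (Σ<-const 1 N))
                 (trans (Σ<-cong N evenRun-odd)
                        (trans (Σ<-+ (λ _ → + 1) (λ j → - evenRun (digitState j)) N)
                               (cong₂ _+_ (Σ<-const 1 N) (Σ<-neg _ N)))) ⟩
      + (N ℕ.* 1) + (+ (N ℕ.* 1) - E N)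
    ≡⟨ cong (λ k → + k + (+ k - E N)) (ℕP.*-identityʳ N) ⟩
      + N + (+ N - E N)
    ∎
    where open ≡-Reasoning

  e-even : ∀ N → e (N ℕ.+ N) ≡ - e N
  e-even N = trans (cong₂ (λ a b → + 3 * a - + 2 * b) (E-even N) (ℤP.pos-+ N N)) (identity (+ N) (E N))
    where
    identity : ∀ n q → + 3 * (n + (n - q)) - + 2 * (n + n) ≡ - (+ 3 * q - + 2 * n)
    identity = solve-∀

  e-odd : ∀ N → e (suc (N ℕ.+ N)) ≡ + 1 - e N
  e-odd N =
    trans (cong₂ (λ a b → + 3 * a - + 2 * b)
                 (trans (Σ<-suc _ (N ℕ.+ N)) (cong₂ _+_ (E-even N) (evenRun-even N)))
                 (trans (ℤP.pos-+ 1 (N ℕ.+ N)) (cong (_+_ (+ 1)) (ℤP.pos-+ N N))))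
          (identity (+ N) (E N))
    where
    identity : ∀ n q → + 3 * ((n + (n - q)) + + 1) - + 2 * (+ 1 + (n + n)) ≡ + 1 - (+ 3 * q - + 2 * n)
    identity = solve-∀

  D-even : ∀ N → D (N ℕ.+ N) ≡ D N
  D-even N = begin
      D (N ℕ.+ N)
    ≡⟨ Σ<-evens-odds _ N ⟩
      Σ< (λ j → r (j ℕ.+ j) * s (j ℕ.+ j)) N + Σ< (λ j → r (suc (j ℕ.+ j)) * s (suc (j ℕ.+ j))) N
    ≡⟨ cong₂ _+_ (Σ<-cong N (λ j → cong₂ _*_ (evenRun-even j) (sign-even j)))
                 (Σ<-cong N (λ j → cong₂ _*_ (evenRun-odd j) (sign-odd j))) ⟩
      Σ< (λ j → + 1 * s j) N + Σ< (λ j → (+ 1 - r j) * - s j) N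
    ≡⟨ sym (Σ<-+ (λ j → + 1 * s j) (λ j → (+ 1 - r j) * - s j) N) ⟩
      Σ< (λ j → + 1 * s j + (+ 1 - r j) * - s j) N
    ≡⟨ Σ<-cong N (λ j → identity (s j) (r j)) ⟩
      D N
    ∎
    where
    open ≡-Reasoning
    r s : ℕ → ℤ
    r m = evenRun (digitState m)
    s m = sign (digitState m)
    identity : ∀ s r → + 1 * s + (+ 1 - r) * - s ≡ r * s
    identity = solve-∀

  D-odd : ∀ N → D (suc (N ℕ.+ N)) ≡ D N + sign (digitState N)
  D-odd N =
    trans (Σ<-suc _ (N ℕ.+ N))
          (cong₂ _+_ (D-even N) (trans (cong₂ _*_ (evenRun-even N) (sign-even N)) (ℤP.*-identityˡ _)))

  private
    ∣1-x∣≤1+∣x∣ : ∀ x → ∣ + 1 - x ∣ ≤ suc ∣ x ∣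
    ∣1-x∣≤1+∣x∣ x = ℤP.∣i-j∣≤∣i∣+∣j∣ (+ 1) x

  ∣e∣≤bitLength : ∀ K → ∣ e K ∣ ≤ bitLength K
  ∣e∣≤bitLength = binary-induction (λ K → ∣ e K ∣ ≤ bitLength K) z≤n even-step odd-step
    where
    even-step : ∀ N → ∣ e (suc N) ∣ ≤ bitLength (suc N) → ∣ e (suc N ℕ.+ suc N) ∣ ≤ bitLength (suc N ℕ.+ suc N)
    even-step N ih =
      subst (_≤ bitLength (suc N ℕ.+ suc N)) (sym (trans (cong ∣_∣ (e-even (suc N))) (ℤP.∣-i∣≡∣i∣ (e (suc N)))))
            (ℕP.≤-trans ih (bitLength-mono (ℕP.m≤m+n (suc N) (suc N))))
    odd-step : ∀ N → ∣ e N ∣ ≤ bitLength N → ∣ e (suc (N ℕ.+ N)) ∣ ≤ bitLength (suc (N ℕ.+ N))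
    odd-step N ih =
      subst₂ _≤_ (cong ∣_∣ (sym (e-odd N))) (sym (bitLength-odd N))
             (ℕP.≤-trans (∣1-x∣≤1+∣x∣ (e N)) (s≤s ih))

  ∣D∣≤bitLength : ∀ K → ∣ D K ∣ ≤ bitLength K
  ∣D∣≤bitLength = binary-induction (λ K → ∣ D K ∣ ≤ bitLength K) z≤n even-step odd-step
    where
    even-step : ∀ N → ∣ D (suc N) ∣ ≤ bitLength (suc N) → ∣ D (suc N ℕ.+ suc N) ∣ ≤ bitLength (suc N ℕ.+ suc N)
    even-step N ih =
      subst (_≤ bitLength (suc N ℕ.+ suc N)) (sym (cong ∣_∣ (D-even (suc N))))
            (ℕP.≤-trans ih (bitLength-mono (ℕP.m≤m+n (suc N) (suc N))))
    odd-step : ∀ N → ∣ D N ∣ ≤ bitLength N → ∣ D (suc (N ℕ.+ N)) ∣ ≤ bitLength (suc (N ℕ.+ N))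
    odd-step N ih =
      subst₂ _≤_ (cong ∣_∣ (sym (D-odd N))) (sym (bitLength-odd N))
             (ℕP.≤-trans (ℤP.∣i+j∣≤∣i∣+∣j∣ (D N) (sign (digitState N)))
                         (subst (λ k → ∣ D N ∣ ℕ.+ k ≤ suc (bitLength N)) (sym (∣sign∣ (digitState N)))
                                (subst (_≤ suc (bitLength N)) (ℕP.+-comm 1 _) (s≤s ih))))


module Counting where

  open import Data.Bool using (Bool; true; false; if_then_else_)
  open import Data.Integer using (ℤ; +_; _+_)
  import Data.Integer.Properties as ℤP
  open import Data.Nat as ℕ using (ℕ; zero; suc; _≤_; z≤n; s≤s)
  import Data.Nat.Properties as ℕP
  open import Data.Nat.Tactic.RingSolver using (solve-∀)
  open import Data.Product using (Σ-syntax; _×_; _,_)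
  open import Function using (_∘_)
  open import Function.Nary.NonDependent using (congₙ)
  open import Relation.Binary.PropositionalEquality
  open import Defs using (countUpTo)

  open FiniteSum
  open BinaryDigits using (bit)

  countBelow : (ℕ → Bool) → ℕ → ℕ
  countBelow A zero    = 0
  countBelow A (suc L) = countBelow A L ℕ.+ bit (A L)

  private
    if-then-1-else-0 : ∀ b → (if b then 1 else 0) ≡ bit b
    if-then-1-else-0 true  = refl
    if-then-1-else-0 false = refl

  countUpTo≡countBelow : ∀ A N → countUpTo A N ≡ countBelow A (suc N)
  countUpTo≡countBelow A zero    = if-then-1-else-0 (A 0)
  countUpTo≡countBelow A (suc N) = cong₂ ℕ._+_ (countUpTo≡countBelow A N) (if-then-1-else-0 (A (suc N)))

  bit≤1 : ∀ b → bit b ≤ 1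
  bit≤1 true  = s≤s z≤n
  bit≤1 false = z≤n

  countBelow-+ : ∀ A n d → Σ[ δ ∈ ℕ ] δ ≤ d × countBelow A (d ℕ.+ n) ≡ countBelow A n ℕ.+ δ
  countBelow-+ A n zero    = 0 , z≤n , sym (ℕP.+-identityʳ _)
  countBelow-+ A n (suc d) with countBelow-+ A n d
  ... | δ , δ≤d , eq =
    δ ℕ.+ bit (A (d ℕ.+ n)) ,
    subst (δ ℕ.+ bit (A (d ℕ.+ n)) ≤_) (ℕP.+-comm d 1) (ℕP.+-mono-≤ δ≤d (bit≤1 (A (d ℕ.+ n)))) ,
    trans (cong (ℕ._+ bit (A (d ℕ.+ n))) eq) (ℕP.+-assoc (countBelow A n) δ _)

  blockCount : (ℕ → Bool) → ℕ → ℕ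
  blockCount A m =
    bit (A (4 ℕ.* m ℕ.+ 0)) ℕ.+ bit (A (4 ℕ.* m ℕ.+ 1)) ℕ.+ bit (A (4 ℕ.* m ℕ.+ 2)) ℕ.+ bit (A (4 ℕ.* m ℕ.+ 3))

  countBelow-4* : ∀ A K → + countBelow A (4 ℕ.* K) ≡ Σ< (λ m → + blockCount A m) K
  countBelow-4* A zero    = refl
  countBelow-4* A (suc K) = begin
      + countBelow A (4 ℕ.* suc K)
    ≡⟨ cong (+_ ∘ countBelow A) (ℕP.*-suc 4 K) ⟩
      + (countBelow A (4 ℕ.* K) ℕ.+ bit (A (4 ℕ.* K)) ℕ.+ bit (A (suc (4 ℕ.* K)))
           ℕ.+ bit (A (suc (suc (4 ℕ.* K)))) ℕ.+ bit (A (suc (suc (suc (4 ℕ.* K))))))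
    ≡⟨ cong +_ (trans (regroup (countBelow A (4 ℕ.* K)) _ _ _ _) (cong (countBelow A (4 ℕ.* K) ℕ.+_) block)) ⟩
      + (countBelow A (4 ℕ.* K) ℕ.+ blockCount A K)
    ≡⟨ trans (ℤP.pos-+ (countBelow A (4 ℕ.* K)) (blockCount A K)) (cong (_+ + blockCount A K) (countBelow-4* A K)) ⟩
      Σ< (λ m → + blockCount A m) K + + blockCount A K
    ≡⟨ sym (Σ<-suc _ K) ⟩
      Σ< (λ m → + blockCount A m) (suc K)
    ∎
    where
    open ≡-Reasoning
    regroup : ∀ c a b d e → c ℕ.+ a ℕ.+ b ℕ.+ d ℕ.+ e ≡ c ℕ.+ (a ℕ.+ b ℕ.+ d ℕ.+ e)
    regroup = solve-∀
    block : bit (A (4 ℕ.* K)) ℕ.+ bit (A (suc (4 ℕ.* K))) ℕ.+ bit (A (suc (suc (4 ℕ.* K))))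
              ℕ.+ bit (A (suc (suc (suc (4 ℕ.* K))))) ≡ blockCount A K
    block = congₙ 4 (λ i j k l → bit (A i) ℕ.+ bit (A j) ℕ.+ bit (A k) ℕ.+ bit (A l))
                  (sym (ℕP.+-identityʳ _)) (ℕP.+-comm 1 (4 ℕ.* K)) (ℕP.+-comm 2 (4 ℕ.* K)) (ℕP.+-comm 3 (4 ℕ.* K))


module MotzkinCounts where

  open import Data.Bool using (Bool)
  open import Data.Fin using (Fin; toℕ; fromℕ<)
  open import Data.Fin.Patterns using (0F; 1F; 2F; 3F)
  open import Data.Fin.Properties using (toℕ-fromℕ<)
  open import Data.Integer using (ℤ; +_; _+_; _*_; _-_; ∣_∣)
  import Data.Integer.Properties as ℤP
  open import Data.Integer.Tactic.RingSolver using (solve-∀)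
  open import Data.Nat as ℕ using (ℕ; _≤_; _%_; _/_)
  import Data.Nat.Properties as ℕP
  open import Data.Nat.DivMod using (m%n<n; m≡m%n+[m/n]*n; m/n≤m)
  open import Function using (_∘_)
  open import Function.Nary.NonDependent using (congₙ)
  open import Data.Product using (Σ-syntax; _×_; _,_)
  open import Relation.Binary.PropositionalEquality
  open import Defs using (motzkin)

  open FiniteSum
  open BinaryDigits using (bit; bitLength; bitLength-mono; bitLength-pos)
  open DigitAutomaton
  open Simulation using (codeAt)
  open MotzkinMod8 using (initialNode; classify-motzkin)
  open DigitSums
  open Counting

  residue : ℕ → ℕ
  residue n = motzkin n % 8

  RespectsClasses : (ℕ → Bool) → Set
  RespectsClasses t = ∀ (r : Fin 8) → t (classify (toℕ r)) ≡ t (toℕ r)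

  valueAt : Fin 4 → DigitState → ℕ
  valueAt s = ⟦ codeAt (initialNode s) ⟧ᶜ

  blockValue : (ℕ → Bool) → DigitState → ℕ
  blockValue t st =
    bit (t (valueAt 0F st)) ℕ.+ bit (t (valueAt 1F st)) ℕ.+ bit (t (valueAt 2F st)) ℕ.+ bit (t (valueAt 3F st))

  test-residue : ∀ t → RespectsClasses t → ∀ m s → t (residue (4 ℕ.* m ℕ.+ toℕ s)) ≡ t (valueAt s (digitState m))
  test-residue t respects m s = begin
      t (residue n)                                 ≡⟨ cong t (sym (toℕ-fromℕ< r<8)) ⟩
      t (toℕ (fromℕ< r<8))                          ≡⟨ sym (respects (fromℕ< r<8)) ⟩
      t (classify (toℕ (fromℕ< r<8)))               ≡⟨ cong (t ∘ classify) (toℕ-fromℕ< r<8) ⟩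
      t (classify (residue n))                      ≡⟨ cong t (classify-motzkin m s) ⟩
      t (valueAt s (digitState m))                  ∎
    where
    open ≡-Reasoning
    n = 4 ℕ.* m ℕ.+ toℕ s
    r<8 = m%n<n (motzkin n) 8

  blockCount-residue : ∀ t → RespectsClasses t → ∀ m → blockCount (t ∘ residue) m ≡ blockValue t (digitState m)
  blockCount-residue t respects m =
    congₙ 4 (λ a b c d → bit a ℕ.+ bit b ℕ.+ bit c ℕ.+ bit d)
            (test-residue t respects m 0F) (test-residue t respects m 1F)
            (test-residue t respects m 2F) (test-residue t respects m 3F)

  BlockValueIs : (ℕ → Bool) → ℕ → ℤ → Set
  BlockValueIs t a b = ∀ st → + 2 * + blockValue t st ≡ + a * evenRun st + b * (evenRun st * sign st)

  module _ (t : ℕ → Bool) (a : ℕ) (b : ℤ) (a≤4 : a ≤ 4) (∣b∣≤1 : ∣ b ∣ ≤ 1)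
           (respects : RespectsClasses t) (linear : BlockValueIs t a b) where

    private
      A = t ∘ residue

    twice-countBelow-4* : ∀ K → + 2 * + countBelow A (4 ℕ.* K) ≡ + a * E K + b * D K
    twice-countBelow-4* K = begin
        + 2 * + countBelow A (4 ℕ.* K)
      ≡⟨ cong (+ 2 *_) (countBelow-4* A K) ⟩
        + 2 * Σ< (λ m → + blockCount A m) K
      ≡⟨ sym (Σ<-*ˡ (+ 2) _ K) ⟩
        Σ< (λ m → + 2 * + blockCount A m) K
      ≡⟨ Σ<-cong K (λ m → trans (cong (λ v → + 2 * + v) (blockCount-residue t respects m)) (linear (digitState m))) ⟩
        Σ< (λ m → + a * evenRun (digitState m) + b * (evenRun (digitState m) * sign (digitState m))) K
      ≡⟨ Σ<-+ _ _ K ⟩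
        Σ< (λ m → + a * evenRun (digitState m)) K + Σ< (λ m → b * (evenRun (digitState m) * sign (digitState m))) K
      ≡⟨ cong₂ _+_ (Σ<-*ˡ (+ a) _ K) (Σ<-*ˡ b _ K) ⟩
        + a * E K + b * D K
      ∎
      where open ≡-Reasoning

    error-4* : ∀ K → + 12 * + countBelow A (4 ℕ.* K) - + a * (+ 4 * + K) ≡ + 2 * + a * e K + + 6 * b * D K
    error-4* K = begin
        + 12 * c - + a * (+ 4 * + K)         ≡⟨ six-times c (+ a) (+ K) ⟩
        + 6 * (+ 2 * c) - + a * (+ 4 * + K)  ≡⟨ cong (λ x → + 6 * x - + a * (+ 4 * + K)) (twice-countBelow-4* K) ⟩
        + 6 * (+ a * E K + b * D K) - + a * (+ 4 * + K)
                                             ≡⟨ regroup (+ a) b (E K) (D K) (+ K) ⟩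
        + 2 * + a * e K + + 6 * b * D K      ∎
      where
      open ≡-Reasoning
      c = + countBelow A (4 ℕ.* K)
      six-times : ∀ c a K → + 12 * c - a * (+ 4 * K) ≡ + 6 * (+ 2 * c) - a * (+ 4 * K)
      six-times = solve-∀
      regroup : ∀ a b E D K → + 6 * (a * E + b * D) - a * (+ 4 * K) ≡ + 2 * a * (+ 3 * E - + 2 * K) + + 6 * b * D
      regroup = solve-∀

    ∣error-4*∣ : ∀ K → ∣ + 2 * + a * e K + + 6 * b * D K ∣ ≤ 14 ℕ.* bitLength K
    ∣error-4*∣ K = begin
        ∣ + 2 * + a * e K + + 6 * b * D K ∣
      ≤⟨ ℤP.∣i+j∣≤∣i∣+∣j∣ (+ 2 * + a * e K) (+ 6 * b * D K) ⟩
        ∣ + 2 * + a * e K ∣ ℕ.+ ∣ + 6 * b * D K ∣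
      ≡⟨ cong₂ ℕ._+_ (trans (ℤP.abs-* (+ 2 * + a) (e K)) (cong (ℕ._* ∣ e K ∣) (ℤP.abs-* (+ 2) (+ a))))
                     (trans (ℤP.abs-* (+ 6 * b) (D K)) (cong (ℕ._* ∣ D K ∣) (ℤP.abs-* (+ 6) b))) ⟩
        2 ℕ.* a ℕ.* ∣ e K ∣ ℕ.+ 6 ℕ.* ∣ b ∣ ℕ.* ∣ D K ∣
      ≤⟨ ℕP.+-mono-≤ (ℕP.*-mono-≤ (ℕP.*-monoʳ-≤ 2 a≤4) (∣e∣≤bitLength K))
                     (ℕP.*-mono-≤ (ℕP.*-monoʳ-≤ 6 ∣b∣≤1) (∣D∣≤bitLength K)) ⟩
        8 ℕ.* bitLength K ℕ.+ 6 ℕ.* bitLength K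
      ≡⟨ sym (ℕP.*-distribʳ-+ (bitLength K) 8 6) ⟩
        14 ℕ.* bitLength K
      ∎
      where open ℕP.≤-Reasoning

    countBelow-error : ∀ L → 1 ≤ L → ∣ + 12 * + countBelow A L - + a * + L ∣ ≤ 62 ℕ.* bitLength L
    countBelow-error L 1≤L = bound (countBelow-+ A (4 ℕ.* K) j)
      where
      K = L / 4
      j = L % 4
      j≤3 : j ≤ 3
      j≤3 = ℕP.≤-pred (m%n<n L 4)
      L≡j+4K : L ≡ j ℕ.+ 4 ℕ.* K
      L≡j+4K = trans (m≡m%n+[m/n]*n L 4) (cong (j ℕ.+_) (ℕP.*-comm K 4))
      X = + 2 * + a * e K + + 6 * b * D K
      bound : Σ[ δ ∈ ℕ ] δ ≤ j × countBelow A (j ℕ.+ 4 ℕ.* K) ≡ countBelow A (4 ℕ.* K) ℕ.+ δ →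
              ∣ + 12 * + countBelow A L - + a * + L ∣ ≤ 62 ℕ.* bitLength L
      bound (δ , δ≤j , count≡) = begin
          ∣ + 12 * + countBelow A L - + a * + L ∣
        ≡⟨ cong ∣_∣ decompose ⟩
          ∣ X + + 12 * + δ - + a * + j ∣
        ≤⟨ ℕP.≤-trans (ℤP.∣i-j∣≤∣i∣+∣j∣ (X + + 12 * + δ) (+ a * + j))
                      (ℕP.+-monoˡ-≤ ∣ + a * + j ∣ (ℤP.∣i+j∣≤∣i∣+∣j∣ X (+ 12 * + δ))) ⟩
          ∣ X ∣ ℕ.+ ∣ + 12 * + δ ∣ ℕ.+ ∣ + a * + j ∣
        ≡⟨ cong₂ (λ u v → ∣ X ∣ ℕ.+ u ℕ.+ v) (ℤP.abs-* (+ 12) (+ δ)) (ℤP.abs-* (+ a) (+ j)) ⟩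
          ∣ X ∣ ℕ.+ 12 ℕ.* δ ℕ.+ a ℕ.* j
        ≤⟨ ℕP.+-mono-≤ (ℕP.+-mono-≤ (ℕP.≤-trans (∣error-4*∣ K) (ℕP.*-monoʳ-≤ 14 (bitLength-mono (m/n≤m L 4))))
                                    (ℕP.*-monoʳ-≤ 12 (ℕP.≤-trans δ≤j j≤3)))
                       (ℕP.*-mono-≤ a≤4 j≤3) ⟩
          14 ℕ.* bitLength L ℕ.+ 36 ℕ.+ 12
        ≡⟨ ℕP.+-assoc (14 ℕ.* bitLength L) 36 12 ⟩
          14 ℕ.* bitLength L ℕ.+ 48
        ≤⟨ ℕP.+-monoʳ-≤ (14 ℕ.* bitLength L) (ℕP.*-monoʳ-≤ 48 (bitLength-pos 1≤L)) ⟩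
          14 ℕ.* bitLength L ℕ.+ 48 ℕ.* bitLength L
        ≡⟨ sym (ℕP.*-distribʳ-+ (bitLength L) 14 48) ⟩
          62 ℕ.* bitLength L
        ∎
        where
        open ℕP.≤-Reasoning
        regroup : ∀ c δ a j K → + 12 * (c + δ) - a * (j + + 4 * K) ≡ (+ 12 * c - a * (+ 4 * K)) + + 12 * δ - a * j
        regroup = solve-∀
        decompose : + 12 * + countBelow A L - + a * + L ≡ X + + 12 * + δ - + a * + j
        decompose =
          trans (cong₂ (λ c l → + 12 * c - + a * l)
                       (trans (cong (+_ ∘ countBelow A) L≡j+4K) (trans (cong +_ count≡) (ℤP.pos-+ _ δ)))
                       (trans (cong +_ L≡j+4K) (trans (ℤP.pos-+ j (4 ℕ.* K)) (cong (_+_ (+ j)) (ℤP.pos-* 4 K)))))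
          (trans (regroup (+ countBelow A (4 ℕ.* K)) (+ δ) (+ a) (+ j) (+ K))
                 (cong (λ x → x + + 12 * + δ - + a * + j) (error-4* K)))


module Density where

  open import Data.Bool using (Bool; if_then_else_)
  open import Data.Empty using (⊥-elim)
  open import Data.Integer as ℤ using (ℤ; +_; +0; +[1+_]; -[1+_]; _+_; _*_; -_; _-_; ∣_∣)
  import Data.Integer.Properties as ℤP
  open import Data.Integer.Tactic.RingSolver using (solve-∀)
  open import Data.Nat as ℕ using (ℕ; zero; suc; _≤_; _<_; z≤n; s≤s)
  import Data.Nat.Properties as ℕP
  import Data.Nat.Tactic.RingSolver as ℕ-Solver
  open import Data.Product using (Σ-syntax; _,_)
  import Data.Rational as ℚ
  open ℚ using (ℚ; mkℚ; 0ℚ; toℚᵘ)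
  import Data.Rational.Properties as ℚP
  import Data.Rational.Unnormalised as ℚᵘ
  import Data.Rational.Unnormalised.Properties as ℚᵘP
  open import Relation.Nullary using (yes; no)
  open import Relation.Binary.PropositionalEquality
  open import Defs using (HasDensity; countUpTo)

  open BinaryDigits using (bit; bitLength; bitLength²; bitLength-pos)
  open Counting using (countBelow; countUpTo≡countBelow; bit≤1)

  K*bitLength<L : ∀ K L → 4 ℕ.* K ℕ.* K < L → K ℕ.* bitLength L < L
  K*bitLength<L K L 4K²<L with K ℕ.* bitLength L ℕP.<? L
  ... | yes K*bl<L = K*bl<L
  ... | no  K*bl≮L = ⊥-elim (ℕP.<⇒≱ 4K²<L (ℕP.*-cancelʳ-≤ L (4 ℕ.* K ℕ.* K) L {{nonZero}} L²≤4K²L))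
    where
    nonZero : ℕ.NonZero L
    nonZero = ℕ.>-nonZero (ℕP.<-≤-trans (s≤s z≤n) 4K²<L)
    L≤K*bl : L ≤ K ℕ.* bitLength L
    L≤K*bl = ℕP.≮⇒≥ K*bl≮L
    L²≤4K²L : L ℕ.* L ≤ (4 ℕ.* K ℕ.* K) ℕ.* L
    L²≤4K²L = begin
        L ℕ.* L                                            ≤⟨ ℕP.*-mono-≤ L≤K*bl L≤K*bl ⟩
        (K ℕ.* bitLength L) ℕ.* (K ℕ.* bitLength L)       ≡⟨ regroup K (bitLength L) ⟩
        (K ℕ.* K) ℕ.* (bitLength L ℕ.* bitLength L)       ≤⟨ ℕP.*-monoʳ-≤ (K ℕ.* K) (bitLength² L) ⟩
        (K ℕ.* K) ℕ.* (4 ℕ.* L)                           ≡⟨ regroup′ K L ⟩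
        (4 ℕ.* K ℕ.* K) ℕ.* L                             ∎
      where
      open ℕP.≤-Reasoning
      regroup : ∀ a b → (a ℕ.* b) ℕ.* (a ℕ.* b) ≡ (a ℕ.* a) ℕ.* (b ℕ.* b)
      regroup = ℕ-Solver.solve-∀
      regroup′ : ∀ a l → (a ℕ.* a) ℕ.* (4 ℕ.* l) ≡ (4 ℕ.* a ℕ.* a) ℕ.* l
      regroup′ = ℕ-Solver.solve-∀

  positive-ℚᵘ : ∀ ε → 0ℚ ℚ.< ε → Σ[ p ∈ ℕ ] Σ[ q ∈ ℕ ] toℚᵘ ε ≡ ℚᵘ.mkℚᵘ (+ suc p) q
  positive-ℚᵘ (mkℚ +[1+ p ] q _) _   = p , q , refl
  positive-ℚᵘ ε@(mkℚ +0 q _)     0<ε = ⊥-elim (ℚP.<-irrefl (sym (ℚP.↥p≡0⇒p≡0 ε refl)) 0<ε)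
  positive-ℚᵘ ε@(mkℚ -[1+ n ] q _) 0<ε = ⊥-elim (ℚP.<-asym 0<ε (ℚP.negative⁻¹ ε))

  ∣c/[1+m]-a/[1+d]∣<ε : ∀ c m a d ε p q → toℚᵘ ε ≡ ℚᵘ.mkℚᵘ (+ suc p) q →
                        ∣ + c * + suc d + - (+ a) * + suc m ∣ ℕ.* suc q < suc p ℕ.* (suc m ℕ.* suc d) →
                        ℚ.∣ (+ c) ℚ./ suc m ℚ.- (+ a) ℚ./ suc d ∣ ℚ.< ε
  ∣c/[1+m]-a/[1+d]∣<ε c m a d ε p q ε≡p/q cross =
    ℚP.toℚᵘ-cancel-< (ℚᵘP.<-respˡ-≃ (ℚᵘP.≃-sym unnormalised) (subst (ℚᵘ._<_ _) (sym ε≡p/q) unnormalised<))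
    where
    u = ℚᵘ.mkℚᵘ (+ c) m
    v = ℚᵘ.mkℚᵘ (+ a) d
    unnormalised< : ℚᵘ.∣ u ℚᵘ.+ ℚᵘ.- v ∣ ℚᵘ.< ℚᵘ.mkℚᵘ (+ suc p) q
    unnormalised< = ℚᵘ.*<* (subst₂ ℤ._<_ (ℤP.pos-* ∣ + c * + suc d + - (+ a) * + suc m ∣ (suc q))
                                         (ℤP.pos-* (suc p) (suc m ℕ.* suc d))
                                         (ℤ.+<+ cross))
    unnormalised : toℚᵘ (ℚ.∣ ℚ.fromℚᵘ u ℚ.- ℚ.fromℚᵘ v ∣) ℚᵘ.≃ ℚᵘ.∣ u ℚᵘ.+ ℚᵘ.- v ∣
    unnormalised =
      ℚᵘP.≃-trans (ℚP.toℚᵘ-homo-∣-∣ _)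
      (ℚᵘP.≃-trans (ℚᵘP.∣-∣-cong (ℚP.toℚᵘ-homo-+ (ℚ.fromℚᵘ u) (ℚ.- ℚ.fromℚᵘ v)))
                   (ℚᵘP.∣-∣-cong (ℚᵘP.+-cong (ℚP.toℚᵘ-fromℚᵘ u)
                                             (ℚᵘP.≃-trans (ℚP.toℚᵘ-homo‿- (ℚ.fromℚᵘ v)) (ℚᵘP.-‿cong (ℚP.toℚᵘ-fromℚᵘ v))))))

  countUpTo-cong : ∀ {A B : ℕ → Bool} → (∀ n → A n ≡ B n) → ∀ N → countUpTo A N ≡ countUpTo B N
  countUpTo-cong A≡B zero    = cong (λ b → if b then 1 else 0) (A≡B 0)
  countUpTo-cong A≡B (suc N) = cong₂ ℕ._+_ (countUpTo-cong A≡B N) (cong (λ b → if b then 1 else 0) (A≡B (suc N)))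

  HasDensity-cong : ∀ {A B : ℕ → Bool} {q} → (∀ n → A n ≡ B n) → HasDensity A q → HasDensity B q
  HasDensity-cong {q = q} A≡B dens ε 0<ε with dens ε 0<ε
  ... | m₀ , close = m₀ , λ m m₀≤m →
    subst (λ c → ℚ.∣ (+ c) ℚ./ suc m ℚ.- q ∣ ℚ.< ε) (countUpTo-cong A≡B (suc m)) (close m m₀≤m)

  density : ∀ (A : ℕ → Bool) a d C →
            (∀ L → 1 ≤ L → ∣ + suc d * + countBelow A L - + a * + L ∣ ≤ C ℕ.* bitLength L) →
            HasDensity A ((+ a) ℚ./ suc d)
  density A a d C error ε 0<ε with positive-ℚᵘ ε 0<ε
  ... | p , q , ε≡p/q = m₀ , λ m m₀≤m → ∣c/[1+m]-a/[1+d]∣<ε (countUpTo A (suc m)) m a d ε p q ε≡p/q (cross m m₀≤m)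
    where
    K = (C ℕ.+ suc d) ℕ.* suc q
    m₀ = 4 ℕ.* K ℕ.* K
    cross : ∀ m → m₀ ≤ m →
            ∣ + countUpTo A (suc m) * + suc d + - (+ a) * + suc m ∣ ℕ.* suc q < suc p ℕ.* (suc m ℕ.* suc d)
    cross m m₀≤m = begin-strict
        ∣ N ∣ ℕ.* suc q
      ≤⟨ ℕP.*-monoˡ-≤ (suc q) ∣N∣≤ ⟩
        (C ℕ.+ suc d) ℕ.* bitLength L ℕ.* suc q
      ≡⟨ swap (C ℕ.+ suc d) (bitLength L) (suc q) ⟩
        K ℕ.* bitLength L
      <⟨ K*bitLength<L K L (s≤s m₀≤m) ⟩
        L
      ≤⟨ ℕP.m≤m*n L (suc d) ⟩
        L ℕ.* suc d
      ≤⟨ ℕP.m≤n*m (L ℕ.* suc d) (suc p) ⟩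
        suc p ℕ.* (L ℕ.* suc d)
      ∎
      where
      open ℕP.≤-Reasoning
      L = suc m
      b = bit (A L)
      N = + countUpTo A (suc m) * + suc d + - (+ a) * + L
      Y = + suc d * + countBelow A L - + a * + L
      b≤bitLength : b ≤ bitLength L
      b≤bitLength = ℕP.≤-trans (bit≤1 (A L)) (bitLength-pos {L} (s≤s z≤n))
      swap : ∀ x y z → x ℕ.* y ℕ.* z ≡ x ℕ.* z ℕ.* y
      swap = ℕ-Solver.solve-∀
      N≡Y+[1+d]b : N ≡ Y + + suc d * + b
      N≡Y+[1+d]b =
        trans (cong (λ x → + x * + suc d + - (+ a) * + L) (countUpTo≡countBelow A (suc m)))
              (trans (cong (λ x → x * + suc d + - (+ a) * + L) (ℤP.pos-+ (countBelow A L) b))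
                     (regroup (+ countBelow A L) (+ b) (+ suc d) (+ a) (+ L)))
        where
        regroup : ∀ c b d a L → (c + b) * d + - a * L ≡ (d * c - a * L) + d * b
        regroup = solve-∀
      ∣N∣≤ : ∣ N ∣ ≤ (C ℕ.+ suc d) ℕ.* bitLength L
      ∣N∣≤ = begin
          ∣ N ∣                                        ≡⟨ cong ∣_∣ N≡Y+[1+d]b ⟩
          ∣ Y + + suc d * + b ∣                        ≤⟨ ℤP.∣i+j∣≤∣i∣+∣j∣ Y (+ suc d * + b) ⟩
          ∣ Y ∣ ℕ.+ ∣ + suc d * + b ∣                  ≡⟨ cong (∣ Y ∣ ℕ.+_) (ℤP.abs-* (+ suc d) (+ b)) ⟩
          ∣ Y ∣ ℕ.+ suc d ℕ.* b                        ≤⟨ ℕP.+-mono-≤ (error L (s≤s z≤n)) (ℕP.*-monoʳ-≤ (suc d) b≤bitLength) ⟩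
          C ℕ.* bitLength L ℕ.+ suc d ℕ.* bitLength L  ≡⟨ sym (ℕP.*-distribʳ-+ (bitLength L) C (suc d)) ⟩
          (C ℕ.+ suc d) ℕ.* bitLength L                ∎


module ResidueDensities where

  open import Data.Bool using (Bool)
  import Data.Bool.Properties as BoolP
  open import Data.Fin using (toℕ)
  open import Data.Fin.Properties using (all?)
  open import Data.Integer using (ℤ; +_; 0ℤ; -1ℤ; ∣_∣)
  open import Data.Nat as ℕ using (ℕ; _≤_; _%_; _≡ᵇ_; z≤n)
  open import Data.Nat.Properties using (≤ᵇ⇒≤; ≤-refl)
  open import Data.Nat.Divisibility using (divides)
  open import Data.Nat.DivMod using (m∣n⇒o%n%m≡o%m)
  open import Data.Rational using (_/_)
  open import Function using (_∘_)
  open import Relation.Nullary using (Dec)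
  open import Relation.Nullary.Decidable using (True; toWitness)
  open import Relation.Binary.PropositionalEquality
  open import Defs using (motzkin; HasDensity)

  open DigitAutomaton using (classify; DigitState-≡)
  open MotzkinCounts
  open Density using (density)

  respectsClasses? : ∀ t → Dec (RespectsClasses t)
  respectsClasses? t = all? (λ r → t (classify (toℕ r)) BoolP.≟ t (toℕ r))

  motzkin-density : ∀ t a b → a ≤ 4 → ∣ b ∣ ≤ 1 → RespectsClasses t → BlockValueIs t a b →
                    HasDensity (t ∘ residue) ((+ a) / 12)
  motzkin-density t a b a≤4 ∣b∣≤1 respects linear =
    density (t ∘ residue) a 11 62 (countBelow-error t a b a≤4 ∣b∣≤1 respects linear)

  isEven : ℕ → Bool
  isEven r = r % 2 ≡ᵇ 0

  isEven-residue : ∀ n → isEven (residue n) ≡ (motzkin n % 2 ≡ᵇ 0)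
  isEven-residue n = cong (_≡ᵇ 0) (m∣n⇒o%n%m≡o%m 2 8 (motzkin n) (divides 4 refl))

  respectsClasses : ∀ t → {True (respectsClasses? t)} → RespectsClasses t
  respectsClasses t {ok} = toWitness ok

  even-density : HasDensity (isEven ∘ residue) ((+ 4) / 12)
  even-density = motzkin-density isEven 4 0ℤ (≤ᵇ⇒≤ 4 4 _) z≤n (respectsClasses isEven) (DigitState-≡ _ _ refl)

  four-density : HasDensity ((_≡ᵇ 4) ∘ residue) ((+ 2) / 12)
  four-density = motzkin-density (_≡ᵇ 4) 2 0ℤ (≤ᵇ⇒≤ 2 4 _) z≤n (respectsClasses (_≡ᵇ 4)) (DigitState-≡ _ _ refl)

  two-density : HasDensity ((_≡ᵇ 2) ∘ residue) ((+ 1) / 12)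
  two-density = motzkin-density (_≡ᵇ 2) 1 (+ 1) (≤ᵇ⇒≤ 1 4 _) ≤-refl (respectsClasses (_≡ᵇ 2)) (DigitState-≡ _ _ refl)

  six-density : HasDensity ((_≡ᵇ 6) ∘ residue) ((+ 1) / 12)
  six-density = motzkin-density (_≡ᵇ 6) 1 -1ℤ (≤ᵇ⇒≤ 1 4 _) ≤-refl (respectsClasses (_≡ᵇ 6)) (DigitState-≡ _ _ refl)

open import Defs
open import Data.Nat using (_%_; _≡ᵇ_)
open import Data.Integer using (+_)
open import Data.Product using (_×_; _,_)
open import Data.Rational using (_/_)
open ResidueDensities
open Density using (HasDensity-cong)

corollary1 : HasDensity (λ n → (motzkin n % 2) ≡ᵇ 0) ((+ 1) / 3)
    × HasDensity (λ n → (motzkin n % 8) ≡ᵇ 4) ((+ 1) / 6)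
    × HasDensity (λ n → (motzkin n % 8) ≡ᵇ 2) ((+ 1) / 12)
    × HasDensity (λ n → (motzkin n % 8) ≡ᵇ 6) ((+ 1) / 12)
corollary1 =
  HasDensity-cong {q = (+ 4) / 12} isEven-residue even-density , four-density , two-density , six-density
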